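{- Let $\Phi=(X,\mathcal{C})$ be an instance of MNAE3SAT and let $G=(V,A\cup E)$ be the mixed graph constructed from $\Phi$ as described in the context. Then there exists a feasible truth assignment for $\Phi$ if and only if $G$ has a 2-vertex-connected orientation.
   Context: MNAE3SAT instance: a finite set $X$ of boolean variables and a set $\mathcal{C}$ of clauses, each clause being a set of 3 distinct (non-negated) variables. A truth assignment $f:X\to\{true,false\}$ is feasible if every clause contains at least one variable assigned true and at least one assigned false. Let $P(\Phi)$ be the set of pairs $(x,C)$ with $x\in C\in\mathcal{C}$. Construction of $G=(V,A\cup E)$: $V$ consists of three vertices $p,q,r$, one vertex $z_C$ for every $C\in\mathcal{C}$, and for every $(x,C)\in P(\Phi)$ four vertices $t^x_C,u^x_C,w^x_C,y^x_C$ (all distinct). $A$ consists of the arcs $pq,qp,pr,rp,qr,rq$; for every $C\in\mathcal{C}$ the arcs $pz_C$ and $z_Cq$; and for every $(x,C)\in P(\Phi)$ the arcs $pt^x_C,\ t^x_Cu^x_C,\ u^x_Cy^x_C,\ y^x_Cu^x_C,\ u^x_Cw^x_C,\ w^x_Cq$. $E$ consists of an edge $z_Cu^x_C$ for every $(x,C)\in P(\Phi)$, and, for every $x\in X$, with $C_1,\dots,C_{\mu(x)}$ an arbitrary fixed ordering of the clauses containing $x$, setting $b^x_1=r$ and $b^x_{3i-1}=y^x_{C_i}$, $b^x_{3i}=w^x_{C_i}$, $b^x_{3i+1}=t^x_{C_i}$ for $i=1,\dots,\mu(x)$, the edges of the cycle $b^x_1b^x_2\cdots b^x_{3\mu(x)+1}b^x_1$.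 An orientation of a mixed graph keeps all arcs of $A$ and replaces each edge $uv\in E$ by exactly one of the arcs $uv$, $vu$. A digraph is 2-vertex-connected if it has at least 3 vertices and for any two vertices $u,v$ there are two directed $uv$-paths sharing no vertices other than $u,v$. -}

module Defs where

open import Data.Nat using (ℕ)
open import Data.Fin using (Fin)
open import Data.Bool using (Bool; true; false)
open import Data.List using (List; []; _∷_; _++_; [_]; concatMap; allFin; length; lookup)
open import Data.List.Membership.Propositional using (_∈_)
open import Data.List.Relation.Unary.Unique.Propositional using (Unique)
open import Data.Product using (Σ; ∃; _×_; _,_)
open import Data.Sum using (_⊎_)
open import Relation.Binary.PropositionalEquality using (_≡_; _≢_)
open import Function.Definitions using (Injective)
open import Function.Bundles using (_⇔_)

-- Clause C is given
-- as an injective map Fin 3 → Fin n (its three distinct variables);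
-- the clause *as a set* is the image.  Since 𝒞 is a set, distinct
-- indices denote distinct sets of variables.

record Instance : Set where
  field
    n m      : ℕ
    cl       : Fin m → Fin 3 → Fin n
    cl-inj   : ∀ C → Injective _≡_ _≡_ (cl C)
    cl-set   : ∀ C C' → (∀ x → (∃ λ j → cl C j ≡ x) ⇔ (∃ λ j → cl C' j ≡ x)) → C ≡ C'

open Instance public

_occursIn_ : {Φ : Instance} → Fin (n Φ) → Fin (m Φ) → Set
_occursIn_ {Φ} x C = ∃ λ j → cl Φ C j ≡ x

Assignment : Instance → Set
Assignment Φ = Fin (n Φ) → Bool

Feasible : (Φ : Instance) → Assignment Φ → Set
Feasible Φ f = ∀ C → (∃ λ j → f (cl Φ C j) ≡ true) × (∃ λ j → f (cl Φ C j) ≡ false)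

-- Vertices of G.  A pair (x,C) ∈ P(Φ) is represented by (C , j) with
-- x = cl C j (a bijection since clauses are injective).
-- t C j = t^x_C, u C j = u^x_C, w C j = w^x_C, y C j = y^x_C.

data Vtx (m : ℕ) : Set where
  p q r      : Vtx m
  z          : Fin m → Vtx m
  t u w y    : Fin m → Fin 3 → Vtx m

data Arc {m : ℕ} : Vtx m → Vtx m → Set where
  pq : Arc p q
  qp : Arc q p
  pr : Arc p r
  rp : Arc r p
  qr : Arc q r
  rq : Arc r q
  pz : ∀ C → Arc p (z C)
  zq : ∀ C → Arc (z C) q
  pt : ∀ C j → Arc p (t C j)
  tu : ∀ C j → Arc (t C j) (u C j)
  uy : ∀ C j → Arc (u C j) (y C j)
  yu : ∀ C j → Arc (y C j) (u C j)
  uw : ∀ C j → Arc (u C j) (w C j)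
  wq : ∀ C j → Arc (w C j) q

-- A fixed ordering C_1,…,C_μ(x) of the clauses containing x, given as
-- a duplicate-free list of pairs (C , j) with cl C j ≡ x, listing all
-- such pairs.
Ordering : Instance → Set
Ordering Φ = (x : Fin (n Φ)) → Σ (List (Fin (m Φ) × Fin 3)) λ L →
  Unique L × (∀ C j → ((C , j) ∈ L) ⇔ (cl Φ C j ≡ x))

pairsAlong : {A : Set} → A → List A → List (A × A)
pairsAlong a []       = []
pairsAlong a (b ∷ bs) = (a , b) ∷ pairsAlong b bs

-- b^x_2 … b^x_{3μ+1} = y,w,t of C_1, …, y,w,t of C_μ
cycleTail : {m : ℕ} → List (Fin m × Fin 3) → List (Vtx m)
cycleTail = concatMap (λ { (C , j) → y C j ∷ w C j ∷ t C j ∷ [] })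

-- the edges of the cycle b_1 b_2 ⋯ b_{3μ+1} b_1 with b_1 = r
cycleEdges : {m : ℕ} → List (Fin m × Fin 3) → List (Vtx m × Vtx m)
cycleEdges L = pairsAlong r (cycleTail L ++ [ r ])

Edges : (Φ : Instance) → Ordering Φ → List (Vtx (m Φ) × Vtx (m Φ))
Edges Φ ord =
  concatMap (λ C → concatMap (λ j → [ (z C , u C j) ]) (allFin 3)) (allFin (m Φ))
  ++ concatMap (λ x → cycleEdges (Data.Product.proj₁ (ord x))) (allFin (n Φ))

orient : {V : Set} → V × V → Bool → V × V
orient (a , b) true  = (a , b)
orient (a , b) false = (b , a)

Orientation : (Φ : Instance) → Ordering Φ → Set
Orientation Φ ord = Fin (length (Edges Φ ord)) → Bool

OArc : (Φ : Instance) (ord : Ordering Φ) → Orientation Φ ord → Vtx (m Φ) → Vtx (m Φ) → Set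
OArc Φ ord o a b = Arc a b ⊎ (∃ λ i → orient (lookup (Edges Φ ord) i) (o i) ≡ (a , b))

data Walk {V : Set} (R : V → V → Set) : V → V → Set where
  [] : ∀ {a} → Walk R a a
  _∷_ : ∀ {a b c} → R a b → Walk R b c → Walk R a c

verts : {V : Set} {R : V → V → Set} {a b : V} → Walk R a b → List V
verts {a = a} []       = a ∷ []
verts {a = a} (_ ∷ ws) = a ∷ verts ws

Path : {V : Set} (R : V → V → Set) → V → V → Set
Path R a b = Σ (Walk R a b) λ W → Unique (verts W)

TwoVertexConnected : {V : Set} → (V → V → Set) → Set
TwoVertexConnected {V} R =
  (Σ V λ a → Σ V λ b → Σ V λ c → a ≢ b × a ≢ c × b ≢ c)
  × (∀ a b → a ≢ b → Σ (Path R a b) λ P₁ → Σ (Path R a b) λ P₂ →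
       ∀ v → v ∈ verts (Data.Product.proj₁ P₁) → v ∈ verts (Data.Product.proj₁ P₂) →
             v ≡ a ⊎ v ≡ b)

module Submission where

-- If f is feasible, orient the cycle of each variable x as r → y → w → t → ⋯ → r when x is true and
-- backwards when it is false, and u^x_C → z_C exactly when x is true.  Then every vertex has two walks to
-- the triangle p q r and two walks from it that meet only in that vertex, so G − v is strongly connected
-- for every v, and the expansion lemma turns this into two internally disjoint paths between any two
-- vertices.  Conversely, in a 2-vertex-connected digraph the arcs leaving a set that separates a from b
-- cannot all pass through one vertex other than a and b.  Around each gadget this forces all edges of a
-- variable cycle to point the same way and ties the direction of u^x_C z_C to it; making x true when its
-- cycle runs forwards, the in-neighbour of z_C other than p and its out-neighbour other than q are
-- u-vertices of a true and of a false variable of C.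

open import Data.Nat using (ℕ)
open import Data.Fin using (Fin; zero; suc) renaming (_≟_ to _≟ᶠ_)
open import Data.Bool using (Bool; true; false; not)
open import Data.List using (List; []; _∷_; _++_; [_]; concatMap; allFin; length; lookup; mapMaybe)
open import Data.List.Membership.Propositional using (_∈_; _∉_; find; lose)
open import Data.List.Membership.Propositional.Properties using (∈-++⁺ˡ; ∈-++⁺ʳ; ∈-++⁻; ∈-∃++; ∈-concatMap⁺; ∈-concatMap⁻; ∈-allFin; ∈-lookup)
open import Data.List.Relation.Binary.Subset.Propositional using (_⊆_)
open import Data.List.Relation.Unary.Any using (here; there)
import Data.List.Relation.Unary.Any as Any
open import Data.List.Relation.Unary.Any.Properties using (lookup-index)
open import Data.List.Relation.Unary.All using (All; []; _∷_)
import Data.List.Relation.Unary.All as All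
open import Data.List.Relation.Unary.All.Properties using (¬Any⇒All¬; All¬⇒¬Any) renaming (map⁺ to All-map⁺; ++⁺ to All-++⁺; ++⁻ˡ to All-++⁻ˡ; ++⁻ʳ to All-++⁻ʳ)
open import Data.List.Relation.Unary.Unique.Propositional using (Unique; []; _∷_)
open import Data.List.Relation.Unary.Unique.Propositional.Properties using (Unique[x∷xs]⇒x∉xs; ++⁺; concat⁺; allFin⁺)
import Data.List.Relation.Unary.AllPairs as AllPairs
open import Data.List.Relation.Unary.AllPairs.Properties using () renaming (map⁺ to AllPairs-map⁺)
open import Data.Product using (Σ; ∃; _×_; _,_; proj₁; proj₂)
import Data.Product.Properties as Product
open import Data.Sum using (_⊎_; inj₁; inj₂; [_,_]′; swap)
import Data.Sum.Properties as Sum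
open import Data.Empty using (⊥; ⊥-elim)
open import Data.Unit using (⊤; tt)
open import Data.List.Properties using (concatMap-++; ++-assoc; ++-identityʳ; mapMaybe-++; concatMap-cong)
open import Data.Maybe using (Maybe; just; nothing)
open import Relation.Nullary using (¬_; yes; no)
open import Relation.Nullary.Decidable using (map′; decidable-stable; _⊎-dec_; ¬?)
open import Relation.Unary using (Decidable)
open import Relation.Binary.Definitions using (DecidableEquality)
open import Relation.Binary.PropositionalEquality using (_≡_; _≢_; refl; sym; trans; cong; cong₂; subst; module ≡-Reasoning)
open import Function.Bundles using (_⇔_; Equivalence; mk⇔)
open import Function using (_∘_)
open import Defs

module _ {A : Set} where

  ∉-∷ : ∀ {x y : A} {xs} → x ≢ y → x ∉ xs → x ∉ y ∷ xs
  ∉-∷ x≢y _   (here x≡y) = x≢y x≡y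
  ∉-∷ _   x∉xs (there x∈xs) = x∉xs x∈xs

  ∉-++ : ∀ {x : A} xs {ys} → x ∉ xs → x ∉ ys → x ∉ xs ++ ys
  ∉-++ xs x∉xs x∉ys x∈ = [ x∉xs , x∉ys ]′ (∈-++⁻ xs x∈)

  Unique-∷ : ∀ {x : A} {xs} → x ∉ xs → Unique xs → Unique (x ∷ xs)
  Unique-∷ x∉xs uxs = ¬Any⇒All¬ _ x∉xs ∷ uxs

  Unique-++⁻ˡ : ∀ (xs : List A) {ys} → Unique (xs ++ ys) → Unique xs
  Unique-++⁻ˡ []       _        = []
  Unique-++⁻ˡ (x ∷ xs) (px ∷ uxs) = All-++⁻ˡ xs px ∷ Unique-++⁻ˡ xs uxs

  Unique-++⁻ʳ : ∀ (xs : List A) {ys} → Unique (xs ++ ys) → Unique ys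
  Unique-++⁻ʳ []       uys       = uys
  Unique-++⁻ʳ (x ∷ xs) (_ ∷ uxs) = Unique-++⁻ʳ xs uxs

  Unique-++⁻-disjoint : ∀ (xs : List A) {ys z} → Unique (xs ++ ys) → z ∈ xs → z ∉ ys
  Unique-++⁻-disjoint (x ∷ xs) (px ∷ _) (here refl) z∈ys = All.lookup (All-++⁻ʳ xs px) z∈ys refl
  Unique-++⁻-disjoint (x ∷ xs) (_ ∷ uxs) (there z∈xs) = Unique-++⁻-disjoint xs uxs z∈xs

  Unique-++⁺ : ∀ {xs ys : List A} → Unique xs → Unique ys → (∀ {z} → z ∈ xs → z ∉ ys) → Unique (xs ++ ys)
  Unique-++⁺ uxs uys disj = ++⁺ uxs uys (λ (z∈xs , z∈ys) → disj z∈xs z∈ys)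

  Unique-concatMap : ∀ {B : Set} (F : B → List A) {xs} → Unique xs → (∀ x → Unique (F x)) →
                     (∀ {x x′ a} → a ∈ F x → a ∈ F x′ → x ≡ x′) → Unique (concatMap F xs)
  Unique-concatMap F uxs uF disj =
    concat⁺ (All-map⁺ (All.tabulate λ {x} _ → uF x))
            (AllPairs-map⁺ (AllPairs.map (λ x≢x′ {_} (a∈ , a∈′) → x≢x′ (disj a∈ a∈′)) uxs))

module _ {A K : Set} (κ : A → Maybe K) where

  mapMaybe-concatMap : ∀ {B : Set} (F : B → List A) xs → mapMaybe κ (concatMap F xs) ≡ concatMap (mapMaybe κ ∘ F) xs
  mapMaybe-concatMap F []       = refl
  mapMaybe-concatMap F (x ∷ xs) = trans (mapMaybe-++ κ (F x) (concatMap F xs)) (cong (mapMaybe κ (F x) ++_) (mapMaybe-concatMap F xs))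

  private
    ∈-mapMaybe⁺ : ∀ xs (i : Fin (length xs)) {k} → κ (lookup xs i) ≡ just k → k ∈ mapMaybe κ xs
    ∈-mapMaybe⁺ (x ∷ xs) zero    κx≡k rewrite κx≡k = here refl
    ∈-mapMaybe⁺ (x ∷ xs) (suc i) κ≡k with κ x
    ... | nothing = ∈-mapMaybe⁺ xs i κ≡k
    ... | just _  = there (∈-mapMaybe⁺ xs i κ≡k)

    Unique-mapMaybe-∷ : ∀ x xs → Unique (mapMaybe κ (x ∷ xs)) → Unique (mapMaybe κ xs)
    Unique-mapMaybe-∷ x xs uk with κ x
    ... | nothing = uk
    ... | just _  = Unique-++⁻ʳ [ _ ] uk

  lookup-key-injective : ∀ xs {i i′ k} → Unique (mapMaybe κ xs) →
                         κ (lookup xs i) ≡ just k → κ (lookup xs i′) ≡ just k → i ≡ i′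
  lookup-key-injective (x ∷ xs) {zero}  {zero}   _  _  _  = refl
  lookup-key-injective (x ∷ xs) {zero}  {suc i′} uk e₁ e₂ rewrite e₁ = ⊥-elim (Unique[x∷xs]⇒x∉xs uk (∈-mapMaybe⁺ xs i′ e₂))
  lookup-key-injective (x ∷ xs) {suc i} {zero}   uk e₁ e₂ rewrite e₂ = ⊥-elim (Unique[x∷xs]⇒x∉xs uk (∈-mapMaybe⁺ xs i e₁))
  lookup-key-injective (x ∷ xs) {suc i} {suc i′} uk e₁ e₂ = cong suc (lookup-key-injective xs (Unique-mapMaybe-∷ x xs uk) e₁ e₂)

module _ {A : Set} where

  pairsAlong-prefix : ∀ (a : A) xs b ys {e} → e ∈ pairsAlong a (xs ++ [ b ]) → e ∈ pairsAlong a (xs ++ b ∷ ys)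
  pairsAlong-prefix a []       b ys (here refl) = here refl
  pairsAlong-prefix a (x ∷ xs) b ys (here refl) = here refl
  pairsAlong-prefix a (x ∷ xs) b ys (there e∈)  = there (pairsAlong-prefix x xs b ys e∈)

  pairsAlong-suffix : ∀ (a : A) xs b ys {e} → e ∈ pairsAlong b ys → e ∈ pairsAlong a (xs ++ b ∷ ys)
  pairsAlong-suffix a []       b ys e∈ = there e∈
  pairsAlong-suffix a (x ∷ xs) b ys e∈ = there (pairsAlong-suffix x xs b ys e∈)

  pairsAlong-All : ∀ {P : A → Set} {a} xs {e} → All P (a ∷ xs) → e ∈ pairsAlong a xs → P (proj₁ e) × P (proj₂ e)
  pairsAlong-All (_ ∷ _)  (pa ∷ pb ∷ _) (here refl) = pa , pb
  pairsAlong-All (_ ∷ xs) (_ ∷ pxs)     (there e∈)  = pairsAlong-All xs pxs e∈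

  mapMaybe-pairsAlong-proj₂ : ∀ {K : Set} (κ : A → Maybe K) a xs → mapMaybe (κ ∘ proj₂) (pairsAlong a xs) ≡ mapMaybe κ xs
  mapMaybe-pairsAlong-proj₂ κ a []       = refl
  mapMaybe-pairsAlong-proj₂ κ a (x ∷ xs) with κ x
  ... | nothing = mapMaybe-pairsAlong-proj₂ κ x xs
  ... | just k  = cong (k ∷_) (mapMaybe-pairsAlong-proj₂ κ x xs)

  mapMaybe-pairsAlong-proj₁ : ∀ {K : Set} (κ : A → Maybe K) a xs b →
                              mapMaybe (κ ∘ proj₁) (pairsAlong a (xs ++ [ b ])) ≡ mapMaybe κ (a ∷ xs)
  mapMaybe-pairsAlong-proj₁ κ a []       b = refl
  mapMaybe-pairsAlong-proj₁ κ a (x ∷ xs) b with κ a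
  ... | nothing = mapMaybe-pairsAlong-proj₁ κ x xs b
  ... | just k  = cong (k ∷_) (mapMaybe-pairsAlong-proj₁ κ x xs b)

private
  Code : ℕ → Set
  Code m = Fin 3 ⊎ Fin m ⊎ Fin 4 × Fin m × Fin 3

  code : ∀ {m} → Vtx m → Code m
  code p       = inj₁ zero
  code q       = inj₁ (suc zero)
  code r       = inj₁ (suc (suc zero))
  code (z C)   = inj₂ (inj₁ C)
  code (t C j) = inj₂ (inj₂ (zero , C , j))
  code (u C j) = inj₂ (inj₂ (suc zero , C , j))
  code (w C j) = inj₂ (inj₂ (suc (suc zero) , C , j))
  code (y C j) = inj₂ (inj₂ (suc (suc (suc zero)) , C , j))

  code-injective : ∀ {m} {a b : Vtx m} → code a ≡ code b → a ≡ b
  code-injective {a = p} {p} refl = refl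
  code-injective {a = q} {q} refl = refl
  code-injective {a = r} {r} refl = refl
  code-injective {a = z _} {z _} refl = refl
  code-injective {a = t _ _} {t _ _} refl = refl
  code-injective {a = u _ _} {u _ _} refl = refl
  code-injective {a = w _ _} {w _ _} refl = refl
  code-injective {a = y _ _} {y _ _} refl = refl

_≟ⱽ_ : ∀ {m} → DecidableEquality (Vtx m)
_≟ⱽ_ {m} a b = map′ code-injective (cong code) (code a ≟ᶜ code b)
  where
  _≟ᶜ_ : DecidableEquality (Code m)
  _≟ᶜ_ = Sum.≡-dec _≟ᶠ_ (Sum.≡-dec _≟ᶠ_ (Product.≡-dec _≟ᶠ_ (Product.≡-dec _≟ᶠ_ _≟ᶠ_)))

module Walks {V : Set} (_≟_ : DecidableEquality V) (R : V → V → Set) where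

  open import Data.List.Membership.DecPropositional _≟_ using (_∈?_)

  private variable a b c d h : V

  infixr 5 _++ᵂ_
  _++ᵂ_ : Walk R a b → Walk R b c → Walk R a c
  []       ++ᵂ W₂ = W₂
  (e ∷ W₁) ++ᵂ W₂ = e ∷ (W₁ ++ᵂ W₂)

  initVerts : Walk R a b → List V
  initVerts []              = []
  initVerts {a = a} (_ ∷ W) = a ∷ initVerts W

  verts≡initVerts∷ʳ : (W : Walk R a b) → verts W ≡ initVerts W ++ [ b ]
  verts≡initVerts∷ʳ []      = refl
  verts≡initVerts∷ʳ (_ ∷ W) = cong (_ ∷_) (verts≡initVerts∷ʳ W)

  verts-++ᵂ : (W₁ : Walk R a b) (W₂ : Walk R b c) → verts (W₁ ++ᵂ W₂) ≡ initVerts W₁ ++ verts W₂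
  verts-++ᵂ []       W₂ = refl
  verts-++ᵂ (_ ∷ W₁) W₂ = cong (_ ∷_) (verts-++ᵂ W₁ W₂)

  start∈verts : (W : Walk R a b) → a ∈ verts W
  start∈verts []      = here refl
  start∈verts (_ ∷ _) = here refl

  end∈verts : (W : Walk R a b) → b ∈ verts W
  end∈verts []      = here refl
  end∈verts (_ ∷ W) = there (end∈verts W)

  initVerts⊆verts : (W : Walk R a b) → initVerts W ⊆ verts W
  initVerts⊆verts W x∈ = subst (_ ∈_) (sym (verts≡initVerts∷ʳ W)) (∈-++⁺ˡ x∈)

  Unique-initVerts : (W : Walk R a b) → Unique (verts W) → Unique (initVerts W)
  Unique-initVerts W uW = Unique-++⁻ˡ _ (subst Unique (verts≡initVerts∷ʳ W) uW)

  end∉initVerts : (W : Walk R a b) → Unique (verts W) → b ∉ initVerts W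
  end∉initVerts W uW b∈ = Unique-++⁻-disjoint _ (subst Unique (verts≡initVerts∷ʳ W) uW) b∈ (here refl)

  ∈-verts-++ᵂ⁻ : ∀ {x} (W₁ : Walk R a b) (W₂ : Walk R b c) → x ∈ verts (W₁ ++ᵂ W₂) → x ∈ initVerts W₁ ⊎ x ∈ verts W₂
  ∈-verts-++ᵂ⁻ W₁ W₂ x∈ = ∈-++⁻ (initVerts W₁) (subst (_ ∈_) (verts-++ᵂ W₁ W₂) x∈)

  ∉-verts-++ᵂ : ∀ {x} (W₁ : Walk R a b) (W₂ : Walk R b c) → x ∉ verts W₁ → x ∉ verts W₂ → x ∉ verts (W₁ ++ᵂ W₂)
  ∉-verts-++ᵂ W₁ W₂ x∉W₁ x∉W₂ x∈ = [ x∉W₁ ∘ initVerts⊆verts W₁ , x∉W₂ ]′ (∈-verts-++ᵂ⁻ W₁ W₂ x∈)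

  Unique-verts-++ᵂ : (W₁ : Walk R a b) (W₂ : Walk R b c) → Unique (initVerts W₁) → Unique (verts W₂) →
                     (∀ {x} → x ∈ initVerts W₁ → x ∉ verts W₂) → Unique (verts (W₁ ++ᵂ W₂))
  Unique-verts-++ᵂ W₁ W₂ u₁ u₂ disj = subst Unique (sym (verts-++ᵂ W₁ W₂)) (Unique-++⁺ u₁ u₂ disj)

  splitAt : ∀ {x} (W : Walk R a c) → x ∈ verts W →
            Σ (Walk R a x) λ W₁ → Σ (Walk R x c) λ W₂ → verts W ≡ initVerts W₁ ++ verts W₂
  splitAt []      (here refl)  = [] , [] , refl
  splitAt (e ∷ W) (here refl)  = [] , e ∷ W , refl
  splitAt (e ∷ W) (there x∈) with splitAt W x∈
  ... | W₁ , W₂ , eq = e ∷ W₁ , W₂ , cong (_ ∷_) eq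

  toPath : (W : Walk R a b) → Σ (Path R a b) λ P → verts (proj₁ P) ⊆ verts W
  toPath [] = ([] , [] ∷ []) , λ x∈ → x∈
  toPath {a = a} (e ∷ W) with toPath W
  ... | (P , uP) , P⊆W with a ∈? verts P
  ...   | no a∉P = (e ∷ P , Unique-∷ a∉P uP) , λ { (here refl) → here refl ; (there x∈) → there (P⊆W x∈) }
  ...   | yes a∈P with splitAt P a∈P
  ...     | _ , P₂ , eq = (P₂ , Unique-++⁻ʳ _ (subst Unique eq uP)) ,
                          λ x∈ → there (P⊆W (subst (_ ∈_) (sym eq) (∈-++⁺ʳ _ x∈)))

  record LastVisit (S : V → Set) (W : Walk R a c) : Set where
    constructor lastVisit
    field
      {last}       : V
      last∈S       : S last
      before       : Walk R a last
      after        : Walk R last c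
      verts-split  : verts W ≡ initVerts before ++ verts after
      after-leaves : ∀ {x} → x ∈ verts after → S x → x ≡ last

  private
    lastVisit? : {S : V → Set} → Decidable S → (W : Walk R a c) → (∀ {x} → x ∈ verts W → ¬ S x) ⊎ LastVisit S W
    lastVisit? {a = a} S? [] with S? a
    ... | yes sa = inj₂ (lastVisit sa [] [] refl λ { (here refl) _ → refl })
    ... | no ¬sa = inj₁ λ { (here refl) → ¬sa }
    lastVisit? {a = a} S? (e ∷ W) with lastVisit? S? W
    ... | inj₂ (lastVisit sh W₁ W₂ eq leaves) = inj₂ (lastVisit sh (e ∷ W₁) W₂ (cong (_ ∷_) eq) leaves)
    ... | inj₁ none with S? a
    ...   | yes sa = inj₂ (lastVisit sa [] (e ∷ W) refl λ { (here refl) _ → refl ; (there x∈) sx → ⊥-elim (none x∈ sx) })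
    ...   | no ¬sa = inj₁ λ { (here refl) → ¬sa ; (there x∈) → none x∈ }

  lastVisitOf : {S : V → Set} → Decidable S → (W : Walk R a c) → S a → LastVisit S W
  lastVisitOf S? W sa with lastVisit? S? W
  ... | inj₁ none = ⊥-elim (none (start∈verts W) sa)
  ... | inj₂ visit = visit

  walkAlong : ∀ a xs b → (∀ {e} → e ∈ pairsAlong a (xs ++ [ b ]) → R (proj₁ e) (proj₂ e)) →
              Σ (Walk R a b) λ W → verts W ⊆ a ∷ xs ++ [ b ]
  walkAlong a []       b arcs = arcs (here refl) ∷ [] , λ x∈ → x∈
  walkAlong a (x ∷ xs) b arcs with walkAlong x xs b (arcs ∘ there)
  ... | W , W⊆ = arcs (here refl) ∷ W , λ { (here refl) → here refl ; (there x∈) → there (W⊆ x∈) }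

  walkAgainst : ∀ a xs b → (∀ {e} → e ∈ pairsAlong a (xs ++ [ b ]) → R (proj₂ e) (proj₁ e)) →
                Σ (Walk R b a) λ W → verts W ⊆ a ∷ xs ++ [ b ]
  walkAgainst a []       b arcs = arcs (here refl) ∷ [] , λ { (here refl) → there (here refl) ; (there (here refl)) → here refl }
  walkAgainst a (x ∷ xs) b arcs with walkAgainst x xs b (arcs ∘ there)
  ... | W , W⊆ = W ++ᵂ arcs (here refl) ∷ [] , λ x∈ → [ there ∘ W⊆ ∘ initVerts⊆verts W , lastArc ]′ (∈-verts-++ᵂ⁻ W _ x∈)
    where
    lastArc : ∀ {v} → v ∈ x ∷ a ∷ [] → v ∈ a ∷ x ∷ xs ++ [ b ]
    lastArc (here refl)         = there (here refl)
    lastArc (there (here refl)) = here refl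

  TwoPaths : V → V → Set
  TwoPaths a b = Σ (Path R a b) λ P₁ → Σ (Path R a b) λ P₂ →
                 ∀ v → v ∈ verts (proj₁ P₁) → v ∈ verts (proj₁ P₂) → v ≡ a ⊎ v ≡ b

  singleArcPaths : a ≢ b → R a b → TwoPaths a b
  singleArcPaths {a = a} {b = b} a≢b e = (e ∷ [] , single) , (e ∷ [] , single) ,
                         λ { _ (here v≡a) _ → inj₁ v≡a ; _ (there (here v≡b)) _ → inj₂ v≡b }
    where
    single : Unique (a ∷ b ∷ [])
    single = Unique-∷ (∉-∷ a≢b λ ()) ([] ∷ [])

  -- Q₁ is cut at h and continued by T, which meets Q₁ ∪ Q₂ only in h; Q₂ is continued by the arc c → d.
  reroute : (Q₁ Q₂ : Walk R a c) → Unique (verts Q₁) → Unique (verts Q₂) →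
            (∀ v → v ∈ verts Q₁ → v ∈ verts Q₂ → v ≡ a ⊎ v ≡ c) →
            R c d → d ≢ c → d ≢ a → h ∈ verts Q₁ →
            (T : Walk R h d) → Unique (verts T) → c ∉ verts T →
            (∀ {x} → x ∈ verts T → x ∈ verts Q₁ ⊎ x ∈ verts Q₂ → x ≡ h) → TwoPaths a d
  reroute {a = a} {c = c} {d = d} {h = h} Q₁ Q₂ uQ₁ uQ₂ disj e d≢c d≢a h∈Q₁ T uT c∉T T-meets-at-h
    with splitAt Q₁ h∈Q₁
  ... | Q₁′ , Q₁″ , split = (Q₁′ ++ᵂ T , unique₁) , (Q₂ ++ᵂ e ∷ [] , unique₂) , disjoint
    where
    uQ₁-split : Unique (initVerts Q₁′ ++ verts Q₁″)
    uQ₁-split = subst Unique split uQ₁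

    Q₁′⊆Q₁ : initVerts Q₁′ ⊆ verts Q₁
    Q₁′⊆Q₁ x∈ = subst (_ ∈_) (sym split) (∈-++⁺ˡ x∈)

    Q₁″∉Q₁′ : ∀ {x} → x ∈ verts Q₁″ → x ∉ initVerts Q₁′
    Q₁″∉Q₁′ x∈″ x∈′ = Unique-++⁻-disjoint _ uQ₁-split x∈′ x∈″

    onT⇒onQ₁ : ∀ {x} → x ∈ verts T → x ∈ verts Q₂ → x ∈ verts Q₁
    onT⇒onQ₁ x∈T x∈Q₂ = subst (_∈ verts Q₁) (sym (T-meets-at-h x∈T (inj₂ x∈Q₂))) h∈Q₁

    d∉Q₂ : d ∉ verts Q₂
    d∉Q₂ d∈Q₂ = [ d≢a , d≢c ]′ (disj d (onT⇒onQ₁ (end∈verts T) d∈Q₂) d∈Q₂)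

    unique₁ : Unique (verts (Q₁′ ++ᵂ T))
    unique₁ = Unique-verts-++ᵂ Q₁′ T (Unique-++⁻ˡ _ uQ₁-split) uT λ x∈Q₁′ x∈T →
      Q₁″∉Q₁′ (start∈verts Q₁″) (subst (_∈ initVerts Q₁′) (T-meets-at-h x∈T (inj₁ (Q₁′⊆Q₁ x∈Q₁′))) x∈Q₁′)

    unique₂ : Unique (verts (Q₂ ++ᵂ e ∷ []))
    unique₂ = Unique-verts-++ᵂ Q₂ (e ∷ []) (Unique-initVerts Q₂ uQ₂) (Unique-∷ (∉-∷ (d≢c ∘ sym) λ ()) ([] ∷ [])) λ
      { x∈Q₂ (here refl)         → end∉initVerts Q₂ uQ₂ x∈Q₂
      ; x∈Q₂ (there (here refl)) → d∉Q₂ (initVerts⊆verts Q₂ x∈Q₂) }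

    disjoint : ∀ v → v ∈ verts (Q₁′ ++ᵂ T) → v ∈ verts (Q₂ ++ᵂ e ∷ []) → v ≡ a ⊎ v ≡ d
    disjoint v v∈₁ v∈₂ with ∈-verts-++ᵂ⁻ Q₂ (e ∷ []) v∈₂ | ∈-verts-++ᵂ⁻ Q₁′ T v∈₁
    ... | inj₂ (there (here v≡d)) | _ = inj₂ v≡d
    ... | inj₂ (here refl) | inj₁ c∈Q₁′ = ⊥-elim (Q₁″∉Q₁′ (end∈verts Q₁″) c∈Q₁′)
    ... | inj₂ (here refl) | inj₂ c∈T   = ⊥-elim (c∉T c∈T)
    ... | inj₁ v∈Q₂ | v∈Q₁′⊎T with [ Q₁′⊆Q₁ , (λ v∈T → onT⇒onQ₁ v∈T (initVerts⊆verts Q₂ v∈Q₂)) ]′ v∈Q₁′⊎T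
    ...   | v∈Q₁ with disj v v∈Q₁ (initVerts⊆verts Q₂ v∈Q₂)
    ...     | inj₁ v≡a  = inj₁ v≡a
    ...     | inj₂ refl = ⊥-elim (end∉initVerts Q₂ uQ₂ v∈Q₂)

  module Expansion (avoiding : ∀ v a b → a ≢ v → b ≢ v → Σ (Walk R a b) λ W → v ∉ verts W) where

    extend : a ≢ c → TwoPaths a c → R c d → d ≢ c → d ≢ a → TwoPaths a d
    extend {a = a} {c = c} {d = d} a≢c ((Q₁ , uQ₁) , (Q₂ , uQ₂) , disj) e d≢c d≢a
      with avoiding c a d a≢c d≢c
    ... | W , c∉W with toPath W
    ... | (T , uT) , T⊆W with lastVisitOf (λ x → x ∈? verts Q₁ ⊎-dec x ∈? verts Q₂) T (inj₁ (start∈verts Q₁))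
    ... | lastVisit h∈Q before after split leaves =
      reroute′ h∈Q after (Unique-++⁻ʳ (initVerts before) (subst Unique split uT))
               (c∉W ∘ T⊆W ∘ subst (_ ∈_) (sym split) ∘ ∈-++⁺ʳ (initVerts before)) leaves
      where
      reroute′ : h ∈ verts Q₁ ⊎ h ∈ verts Q₂ → (T′ : Walk R h d) → Unique (verts T′) → c ∉ verts T′ →
                 (∀ {x} → x ∈ verts T′ → x ∈ verts Q₁ ⊎ x ∈ verts Q₂ → x ≡ h) → TwoPaths a d
      reroute′ (inj₁ h∈Q₁) = reroute Q₁ Q₂ uQ₁ uQ₂ disj e d≢c d≢a h∈Q₁
      reroute′ (inj₂ h∈Q₂) T′ uT′ c∉T′ leaves′ with
        reroute Q₂ Q₁ uQ₂ uQ₁ (λ v v∈₂ v∈₁ → disj v v∈₁ v∈₂) e d≢c d≢a h∈Q₂ T′ uT′ c∉T′ (λ x∈ → leaves′ x∈ ∘ swap)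
      ... | P₂ , P₁ , disj′ = P₁ , P₂ , λ v v∈₁ v∈₂ → disj′ v v∈₂ v∈₁

    extendAlong : a ≢ c → TwoPaths a c → (T : Walk R c b) → Unique (verts T) → a ∉ verts T → TwoPaths a b
    extendAlong a≢c paths []      _          _   = paths
    extendAlong {a = a} a≢c paths (_∷_ {b = d} e T) (c∉T ∷ uT) a∉T =
      extendAlong a≢d (extend a≢c paths e (All.lookup c∉T (start∈verts T) ∘ sym) (a≢d ∘ sym)) T uT (a∉T ∘ there)
      where
      a≢d : a ≢ d
      a≢d a≡d = a∉T (there (subst (_∈ verts T) (sym a≡d) (start∈verts T)))

    twoPaths : (∀ a b → Σ V λ v → v ≢ a × v ≢ b) → ∀ a b → a ≢ b → TwoPaths a b
    twoPaths third a b a≢b with third a b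
    ... | v , v≢a , v≢b with toPath (proj₁ (avoiding v a b (v≢a ∘ sym) (v≢b ∘ sym)))
    ... | ([] , _) , _ = ⊥-elim (a≢b refl)
    ... | (_∷_ {b = d} e T , a∉T ∷ uT) , _ = extendAlong a≢d (singleArcPaths a≢d e) T uT (All¬⇒¬Any a∉T)
      where
      a≢d : a ≢ d
      a≢d = All.lookup a∉T (start∈verts T)

  ThreeDistinct : Set
  ThreeDistinct = Σ V λ v₁ → Σ V λ v₂ → Σ V λ v₃ → v₁ ≢ v₂ × v₁ ≢ v₃ × v₂ ≢ v₃

  thirdVertex : ThreeDistinct → ∀ a b → Σ V λ v → v ≢ a × v ≢ b
  thirdVertex (v₁ , v₂ , v₃ , v₁≢v₂ , v₁≢v₃ , v₂≢v₃) a b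
    with v₁ ∈? a ∷ b ∷ [] | v₂ ∈? a ∷ b ∷ [] | v₃ ∈? a ∷ b ∷ []
  ... | no v₁∉ | _ | _ = v₁ , v₁∉ ∘ here , v₁∉ ∘ there ∘ here
  ... | _ | no v₂∉ | _ = v₂ , v₂∉ ∘ here , v₂∉ ∘ there ∘ here
  ... | _ | _ | no v₃∉ = v₃ , v₃∉ ∘ here , v₃∉ ∘ there ∘ here
  ... | yes (here refl)         | yes (here refl)         | _                       = ⊥-elim (v₁≢v₂ refl)
  ... | yes (there (here refl)) | yes (there (here refl)) | _                       = ⊥-elim (v₁≢v₂ refl)
  ... | yes (here refl)         | yes (there (here refl)) | yes (here refl)         = ⊥-elim (v₁≢v₃ refl)
  ... | yes (here refl)         | yes (there (here refl)) | yes (there (here refl)) = ⊥-elim (v₂≢v₃ refl)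
  ... | yes (there (here refl)) | yes (here refl)         | yes (here refl)         = ⊥-elim (v₂≢v₃ refl)
  ... | yes (there (here refl)) | yes (here refl)         | yes (there (here refl)) = ⊥-elim (v₁≢v₃ refl)

  twoVertexConnected : (∀ v a b → a ≢ v → b ≢ v → Σ (Walk R a b) λ W → v ∉ verts W) →
                       ThreeDistinct → TwoVertexConnected R
  twoVertexConnected avoiding three = three , Expansion.twoPaths avoiding (thirdVertex three)

  record LeavingArc (S : V → Set) : Set where
    constructor leaving
    field
      {source target} : V
      source∈S : S source
      target∉S : ¬ S target
      arc      : R source target

  open LeavingArc

  leavingArcOn : {S : V → Set} → Decidable S → S a → ¬ S b → (W : Walk R a b) →
                 Σ (LeavingArc S) λ ℓ → source ℓ ∈ verts W × target ℓ ∈ verts W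
  leavingArcOn S? sa ¬sb [] = ⊥-elim (¬sb sa)
  leavingArcOn S? sa ¬sb (_∷_ {b = c} e W) with S? c
  ... | no ¬sc = leaving sa ¬sc e , here refl , there (start∈verts W)
  ... | yes sc with leavingArcOn S? sc ¬sb W
  ...   | ℓ , source∈ , target∈ = ℓ , there source∈ , there target∈

  ends : {S : V → Set} → LeavingArc S → List V
  ends ℓ = source ℓ ∷ target ℓ ∷ []

  module TwoConnected (twoPaths : ∀ a b → a ≢ b → TwoPaths a b) where

    twoLeavingArcs : {S : V → Set} → Decidable S → S a → ¬ S b →
                     Σ (LeavingArc S) λ ℓ₁ → Σ (LeavingArc S) λ ℓ₂ → ∀ x → x ∈ ends ℓ₁ → x ∈ ends ℓ₂ → x ≡ a ⊎ x ≡ b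
    twoLeavingArcs {a = a} {b = b} {S = S} S? sa ¬sb with twoPaths a b (λ a≡b → ¬sb (subst S a≡b sa))
    ... | (P₁ , _) , (P₂ , _) , disj with leavingArcOn S? sa ¬sb P₁ | leavingArcOn S? sa ¬sb P₂
    ... | ℓ₁ , s₁∈ , t₁∈ | ℓ₂ , s₂∈ , t₂∈ = ℓ₁ , ℓ₂ , λ x x∈₁ x∈₂ → disj x (onP₁ x∈₁) (onP₂ x∈₂)
      where
      onP₁ : ∀ {x} → x ∈ ends ℓ₁ → x ∈ verts P₁
      onP₁ (here refl)         = s₁∈
      onP₁ (there (here refl)) = t₁∈
      onP₂ : ∀ {x} → x ∈ ends ℓ₂ → x ∈ verts P₂
      onP₂ (here refl)         = s₂∈
      onP₂ (there (here refl)) = t₂∈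

    noCutVertex : ∀ {k} {S : V → Set} → Decidable S → S a → ¬ S b → k ≢ a → k ≢ b →
                  ¬ (∀ (ℓ : LeavingArc S) → source ℓ ≡ k ⊎ target ℓ ≡ k)
    noCutVertex S? sa ¬sb k≢a k≢b throughK with twoLeavingArcs S? sa ¬sb
    ... | ℓ₁ , ℓ₂ , disj = [ k≢a , k≢b ]′ (disj _ (k∈ ℓ₁ (throughK ℓ₁)) (k∈ ℓ₂ (throughK ℓ₂)))
      where
      k∈ : ∀ {k} (ℓ : LeavingArc _) → source ℓ ≡ k ⊎ target ℓ ≡ k → k ∈ ends ℓ
      k∈ ℓ (inj₁ refl) = here refl
      k∈ ℓ (inj₂ refl) = there (here refl)

    private
      arcInto : ∀ {b} (ℓ : LeavingArc (_≢ b)) → R (source ℓ) b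
      arcInto {b} ℓ = subst (R _) (decidable-stable (target ℓ ≟ b) (target∉S ℓ)) (arc ℓ)

      arcOutOf : ∀ {b} (ℓ : LeavingArc (_≡ b)) → R b (target ℓ)
      arcOutOf ℓ = subst (λ s → R s _) (source∈S ℓ) (arc ℓ)

    inNeighbourAvoiding : ∀ a {b c} → a ≢ b → c ≢ a → c ≢ b → Σ V λ s → R s b × s ≢ c
    inNeighbourAvoiding a {b} {c} a≢b c≢a c≢b with twoLeavingArcs (λ x → ¬? (x ≟ b)) a≢b (λ b≢b → b≢b refl)
    ... | ℓ₁ , ℓ₂ , disj with source ℓ₁ ≟ c | source ℓ₂ ≟ c
    ... | no s₁≢c  | _        = source ℓ₁ , arcInto ℓ₁ , s₁≢c
    ... | yes _    | no s₂≢c  = source ℓ₂ , arcInto ℓ₂ , s₂≢c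
    ... | yes refl | yes s₂≡c = ⊥-elim ([ c≢a , c≢b ]′ (disj c (here refl) (here (sym s₂≡c))))

    outNeighbourAvoiding : ∀ a {b c} → b ≢ a → c ≢ a → c ≢ b → Σ V λ s → R b s × s ≢ c
    outNeighbourAvoiding a {b} {c} b≢a c≢a c≢b with twoLeavingArcs (λ x → x ≟ b) refl (b≢a ∘ sym)
    ... | ℓ₁ , ℓ₂ , disj with target ℓ₁ ≟ c | target ℓ₂ ≟ c
    ... | no t₁≢c  | _        = target ℓ₁ , arcOutOf ℓ₁ , t₁≢c
    ... | yes _    | no t₂≢c  = target ℓ₂ , arcOutOf ℓ₂ , t₂≢c
    ... | yes refl | yes t₂≡c = ⊥-elim ([ c≢b , c≢a ]′ (disj c (there (here refl)) (there (here (sym t₂≡c)))))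

module _ {M : ℕ} where

  OnCycle : Vtx M → Set
  OnCycle r       = ⊤
  OnCycle (y _ _) = ⊤
  OnCycle (w _ _) = ⊤
  OnCycle (t _ _) = ⊤
  OnCycle _       = ⊥

  data GadgetVertex (C : Fin M) (j : Fin 3) : Vtx M → Set where
    atY : GadgetVertex C j (y C j)
    atW : GadgetVertex C j (w C j)
    atT : GadgetVertex C j (t C j)

  cycleTail-++ : (L₁ L₂ : List (Fin M × Fin 3)) → cycleTail (L₁ ++ L₂) ≡ cycleTail L₁ ++ cycleTail L₂
  cycleTail-++ L₁ L₂ = concatMap-++ _ L₁ L₂

  ∈-cycleTail⁻ : ∀ {v} (L : List (Fin M × Fin 3)) → v ∈ cycleTail L →
                 ∃ λ C → ∃ λ j → (C , j) ∈ L × GadgetVertex C j v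
  ∈-cycleTail⁻ ((C , j) ∷ L) (here refl)                 = C , j , here refl , atY
  ∈-cycleTail⁻ ((C , j) ∷ L) (there (here refl))         = C , j , here refl , atW
  ∈-cycleTail⁻ ((C , j) ∷ L) (there (there (here refl))) = C , j , here refl , atT
  ∈-cycleTail⁻ ((C , j) ∷ L) (there (there (there v∈))) with ∈-cycleTail⁻ L v∈
  ... | C′ , j′ , C′j′∈ , at = C′ , j′ , there C′j′∈ , at

  gadget-unique : ∀ {C C′ j j′ v} → GadgetVertex C j v → GadgetVertex C′ j′ v → (C , j) ≡ (C′ , j′)
  gadget-unique atY atY = refl
  gadget-unique atW atW = refl
  gadget-unique atT atT = refl

  gadget∈cycleTail⁻ : ∀ {C j v} (L : List (Fin M × Fin 3)) → GadgetVertex C j v → v ∈ cycleTail L → (C , j) ∈ L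
  gadget∈cycleTail⁻ L at v∈ with ∈-cycleTail⁻ L v∈
  ... | _ , _ , C′j′∈ , at′ = subst (_∈ L) (sym (gadget-unique at at′)) C′j′∈

  Unique-cycleTail : (L : List (Fin M × Fin 3)) → Unique L → Unique (cycleTail L)
  Unique-cycleTail []            _          = []
  Unique-cycleTail ((C , j) ∷ L) (Cj∉L ∷ uL) =
    Unique-∷ (∉-∷ (λ ()) (∉-∷ (λ ()) (Cj∉L′ ∘ gadget∈cycleTail⁻ L atY)))
      (Unique-∷ (∉-∷ (λ ()) (Cj∉L′ ∘ gadget∈cycleTail⁻ L atW))
        (Unique-∷ (Cj∉L′ ∘ gadget∈cycleTail⁻ L atT) (Unique-cycleTail L uL)))
    where
    Cj∉L′ : (C , j) ∉ L
    Cj∉L′ = All¬⇒¬Any Cj∉L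

  All-OnCycle-cycleTail : (L : List (Fin M × Fin 3)) → All OnCycle (cycleTail L)
  All-OnCycle-cycleTail []      = []
  All-OnCycle-cycleTail (_ ∷ L) = tt ∷ tt ∷ tt ∷ All-OnCycle-cycleTail L

  offCycle∉ : ∀ {v S} → All OnCycle S → ¬ OnCycle v → v ∉ S
  offCycle∉ onS ¬onV v∈S = ¬onV (All.lookup onS v∈S)

module Construction (Φ : Instance) (ord : Ordering Φ) where

  V : Set
  V = Vtx (m Φ)

  E : List (V × V)
  E = Edges Φ ord

  Occurrence : Set
  Occurrence = Fin (m Φ) × Fin 3

  occurrences : Fin (n Φ) → List Occurrence
  occurrences x = proj₁ (ord x)

  Unique-occurrences : ∀ x → Unique (occurrences x)
  Unique-occurrences x = proj₁ (proj₂ (ord x))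

  ∈-occurrences : ∀ C j → (C , j) ∈ occurrences (cl Φ C j)
  ∈-occurrences C j = Equivalence.from (proj₂ (proj₂ (ord (cl Φ C j))) C j) refl

  ∈-occurrences⁻ : ∀ {x C j} → (C , j) ∈ occurrences x → cl Φ C j ≡ x
  ∈-occurrences⁻ {x} {C} {j} = Equivalence.to (proj₂ (proj₂ (ord x)) C j)

  clauseEdges : List (V × V)
  clauseEdges = concatMap (λ C → concatMap (λ j → [ (z C , u C j) ]) (allFin 3)) (allFin (m Φ))

  variableEdges : List (V × V)
  variableEdges = concatMap (λ x → cycleEdges (occurrences x)) (allFin (n Φ))

  zu∈E : ∀ C j → (z C , u C j) ∈ E
  zu∈E C j = ∈-++⁺ˡ (∈-concatMap⁺ _ (lose (∈-allFin C) (∈-concatMap⁺ (λ j′ → [ (z C , u C j′) ]) (lose (∈-allFin j) (here refl)))))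

  cycleEdge∈E : ∀ x {e} → e ∈ cycleEdges (occurrences x) → e ∈ E
  cycleEdge∈E x e∈ = ∈-++⁺ʳ clauseEdges (∈-concatMap⁺ _ (lose (∈-allFin x) e∈))

  cycle-++ : ∀ {x} A K → occurrences x ≡ A ++ K → cycleTail (occurrences x) ++ [ r ] ≡ cycleTail A ++ cycleTail K ++ [ r ]
  cycle-++ {x} A K split = begin
    cycleTail (occurrences x) ++ [ r ]          ≡⟨ cong (λ L → cycleTail L ++ [ r ]) split ⟩
    cycleTail (A ++ K) ++ [ r ]                 ≡⟨ cong (_++ [ r ]) (cycleTail-++ A K) ⟩
    (cycleTail A ++ cycleTail K) ++ [ r ]       ≡⟨ ++-assoc (cycleTail A) (cycleTail K) [ r ] ⟩
    cycleTail A ++ cycleTail K ++ [ r ]         ∎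
    where open ≡-Reasoning

  consecutive∈cycle : ∀ x A C j C′ j′ B → occurrences x ≡ A ++ (C , j) ∷ (C′ , j′) ∷ B →
                      (t C j , y C′ j′) ∈ cycleEdges (occurrences x)
  consecutive∈cycle x A C j C′ j′ B split =
    subst (λ xs → _ ∈ pairsAlong r xs) (sym (cycle-++ A ((C , j) ∷ (C′ , j′) ∷ B) split))
      (pairsAlong-suffix r (cycleTail A) (y C j) _ (there (there (here refl))))

  record Position (C : Fin (m Φ)) (j : Fin 3) : Set where
    field
      earlier later : List Occurrence
      occurrences-split : occurrences (cl Φ C j) ≡ earlier ++ (C , j) ∷ later
      ∉earlier : (C , j) ∉ earlier
      ∉later   : (C , j) ∉ later

  position : ∀ C j → Position C j
  position C j with ∈-∃++ (∈-occurrences C j)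
  ... | earlier , later , split = record
    { earlier = earlier ; later = later ; occurrences-split = split
    ; ∉earlier = λ Cj∈ → Unique-++⁻-disjoint earlier unique Cj∈ (here refl)
    ; ∉later   = Unique[x∷xs]⇒x∉xs (Unique-++⁻ʳ earlier unique)
    }
    where
    unique : Unique (earlier ++ (C , j) ∷ later)
    unique = subst Unique split (Unique-occurrences (cl Φ C j))

  module Gadget (C : Fin (m Φ)) (j : Fin 3) where
    open Position (position C j) public

    private
      onCycle : ∀ {e} → e ∈ pairsAlong r (cycleTail earlier ++ y C j ∷ w C j ∷ t C j ∷ cycleTail later ++ [ r ]) →
                e ∈ cycleEdges (occurrences (cl Φ C j))
      onCycle = subst (λ xs → _ ∈ pairsAlong r xs) (sym (cycle-++ earlier ((C , j) ∷ later) occurrences-split))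

    edges-toY : ∀ {e} → e ∈ pairsAlong r (cycleTail earlier ++ [ y C j ]) → e ∈ cycleEdges (occurrences (cl Φ C j))
    edges-toY = onCycle ∘ pairsAlong-prefix r (cycleTail earlier) (y C j) _

    yw∈cycle : (y C j , w C j) ∈ cycleEdges (occurrences (cl Φ C j))
    yw∈cycle = onCycle (pairsAlong-suffix r (cycleTail earlier) (y C j) _ (here refl))

    wt∈cycle : (w C j , t C j) ∈ cycleEdges (occurrences (cl Φ C j))
    wt∈cycle = onCycle (pairsAlong-suffix r (cycleTail earlier) (y C j) _ (there (here refl)))

    edges-fromT : ∀ {e} → e ∈ pairsAlong (t C j) (cycleTail later ++ [ r ]) → e ∈ cycleEdges (occurrences (cl Φ C j))
    edges-fromT = onCycle ∘ pairsAlong-suffix r (cycleTail earlier) (y C j) _ ∘ there ∘ there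

    w∉earlier : w C j ∉ r ∷ cycleTail earlier ++ [ y C j ]
    w∉earlier = ∉-∷ (λ ()) (∉-++ (cycleTail earlier) (∉earlier ∘ gadget∈cycleTail⁻ earlier atW) (∉-∷ (λ ()) λ ()))

    t∉earlier : t C j ∉ r ∷ cycleTail earlier ++ [ y C j ]
    t∉earlier = ∉-∷ (λ ()) (∉-++ (cycleTail earlier) (∉earlier ∘ gadget∈cycleTail⁻ earlier atT) (∉-∷ (λ ()) λ ()))

    w∉later : w C j ∉ cycleTail later ++ [ r ]
    w∉later = ∉-++ (cycleTail later) (∉later ∘ gadget∈cycleTail⁻ later atW) (∉-∷ (λ ()) λ ())

    OnCycle-toY : All OnCycle (r ∷ cycleTail earlier ++ [ y C j ])
    OnCycle-toY = tt ∷ All-++⁺ (All-OnCycle-cycleTail earlier) (tt ∷ [])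

    OnCycle-fromT : All OnCycle (t C j ∷ cycleTail later ++ [ r ])
    OnCycle-fromT = tt ∷ All-++⁺ (All-OnCycle-cycleTail later) (tt ∷ [])

module Forward (Φ : Instance) (ord : Ordering Φ) (f : Assignment Φ) (feasible : Feasible Φ f) where
  open Construction Φ ord

  direction : V × V → Bool
  direction (z _ , u C j) = not (f (cl Φ C j))
  direction (y C j , _)   = f (cl Φ C j)
  direction (w C j , _)   = f (cl Φ C j)
  direction (t C j , _)   = f (cl Φ C j)
  direction (r , y C j)   = f (cl Φ C j)
  direction _             = true

  orientation : Orientation Φ ord
  orientation i = direction (lookup E i)

  G : V → V → Set
  G = OArc Φ ord orientation

  open Walks _≟ⱽ_ G

  fixed : ∀ {a b} → Arc a b → G a b
  fixed = inj₁

  edgeArc : ∀ {e a b} → e ∈ E → orient e (direction e) ≡ (a , b) → G a b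
  edgeArc e∈ eq = inj₂ (Any.index e∈ , subst (λ e → orient e (direction e) ≡ _) (lookup-index e∈) eq)

  cycleDirection : ∀ x {e} → e ∈ cycleEdges (occurrences x) → orient e (direction e) ≡ orient e (f x)
  cycleDirection x = fromR (occurrences x) ∈-occurrences⁻
    where
    OfX : List Occurrence → Set
    OfX L = ∀ {C j} → (C , j) ∈ L → cl Φ C j ≡ x

    fromT : ∀ C j L → cl Φ C j ≡ x → OfX L → ∀ {e} →
            e ∈ pairsAlong (t C j) (cycleTail L ++ [ r ]) → orient e (direction e) ≡ orient e (f x)
    fromT C j []              Cj∈x _   (here refl)                 = cong (orient _ ∘ f) Cj∈x
    fromT C j (_ ∷ L)         Cj∈x _   (here refl)                 = cong (orient _ ∘ f) Cj∈x
    fromT C j ((C′ , j′) ∷ L) _    ofL (there (here refl))         = cong (orient _ ∘ f) (ofL (here refl))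
    fromT C j ((C′ , j′) ∷ L) _    ofL (there (there (here refl))) = cong (orient _ ∘ f) (ofL (here refl))
    fromT C j ((C′ , j′) ∷ L) _    ofL (there (there (there e∈)))  = fromT C′ j′ L (ofL (here refl)) (ofL ∘ there) e∈

    fromR : ∀ L → OfX L → ∀ {e} → e ∈ pairsAlong r (cycleTail L ++ [ r ]) → orient e (direction e) ≡ orient e (f x)
    fromR []              _   (here refl) with f x
    ... | true  = refl
    ... | false = refl
    fromR ((C , j) ∷ L) ofL (here refl)                 = cong (orient _ ∘ f) (ofL (here refl))
    fromR ((C , j) ∷ L) ofL (there (here refl))         = cong (orient _ ∘ f) (ofL (here refl))
    fromR ((C , j) ∷ L) ofL (there (there (here refl))) = cong (orient _ ∘ f) (ofL (here refl))
    fromR ((C , j) ∷ L) ofL (there (there (there e∈)))  = fromT C j L (ofL (here refl)) (ofL ∘ there) e∈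

  alongCycle : ∀ {x e} → f x ≡ true → e ∈ cycleEdges (occurrences x) → G (proj₁ e) (proj₂ e)
  alongCycle {x} {e} fx e∈ = edgeArc (cycleEdge∈E x e∈) (trans (cycleDirection x e∈) (cong (orient e) fx))

  againstCycle : ∀ {x e} → f x ≡ false → e ∈ cycleEdges (occurrences x) → G (proj₂ e) (proj₁ e)
  againstCycle {x} {e} fx e∈ = edgeArc (cycleEdge∈E x e∈) (trans (cycleDirection x e∈) (cong (orient e) fx))

  uz-arc : ∀ C j → f (cl Φ C j) ≡ true → G (u C j) (z C)
  uz-arc C j fx = edgeArc (zu∈E C j) (cong (orient (z C , u C j) ∘ not) fx)

  zu-arc : ∀ C j → f (cl Φ C j) ≡ false → G (z C) (u C j)
  zu-arc C j fx = edgeArc (zu∈E C j) (cong (orient (z C , u C j) ∘ not) fx)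

  data Hub : V → Set where
    hubP : Hub p
    hubQ : Hub q
    hubR : Hub r

  BoundedWalk : V → V → List V → Set
  BoundedWalk a b S = Σ (Walk G a b) λ W → verts W ⊆ S

  infixr 5 _◅_
  infixl 5 _▻_

  _◅_ : ∀ {a b c S} → G a b → BoundedWalk b c S → BoundedWalk a c (a ∷ S)
  e ◅ (W , W⊆S) = e ∷ W , λ { (here refl) → here refl ; (there x∈) → there (W⊆S x∈) }

  _▻_ : ∀ {a b c S} → BoundedWalk a b S → G b c → BoundedWalk a c (S ++ [ c ])
  (W , W⊆S) ▻ e = W ++ᵂ e ∷ [] , λ x∈ → [ ∈-++⁺ˡ ∘ W⊆S ∘ initVerts⊆verts W , lastStep ]′ (∈-verts-++ᵂ⁻ W _ x∈)
    where
    lastStep : ∀ {x} → x ∈ _ ∷ _ ∷ [] → x ∈ _ ++ [ _ ]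
    lastStep (here refl)         = ∈-++⁺ˡ (W⊆S (end∈verts W))
    lastStep (there (here refl)) = ∈-++⁺ʳ _ (here refl)

  stay : ∀ {a} → BoundedWalk a a [ a ]
  stay = [] , λ x∈ → x∈

  record OutFan (a : V) : Set where
    constructor outFan
    field
      {hub₁ hub₂} : V
      {S₁ S₂}     : List V
      isHub₁ : Hub hub₁
      isHub₂ : Hub hub₂
      walk₁  : BoundedWalk a hub₁ S₁
      walk₂  : BoundedWalk a hub₂ S₂
      meet   : ∀ {x} → x ∈ S₁ → x ∈ S₂ → x ≡ a

  record InFan (a : V) : Set where
    constructor inFan
    field
      {hub₁ hub₂} : V
      {S₁ S₂}     : List V
      isHub₁ : Hub hub₁
      isHub₂ : Hub hub₂
      walk₁  : BoundedWalk hub₁ a S₁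
      walk₂  : BoundedWalk hub₂ a S₂
      meet   : ∀ {x} → x ∈ S₁ → x ∈ S₂ → x ≡ a

  meetAtHead : ∀ {a : V} {S₁ S₂ x} → All (_∉ S₁) S₂ → x ∈ S₁ → x ∈ a ∷ S₂ → x ≡ a
  meetAtHead _     _     (here refl)   = refl
  meetAtHead ∉S₁ x∈S₁ (there x∈S₂) = ⊥-elim (All.lookup ∉S₁ x∈S₂ x∈S₁)

  meetAtLast : ∀ {a : V} {S₁ x} S₂ → All (_∉ S₁) S₂ → x ∈ S₁ → x ∈ S₂ ++ [ a ] → x ≡ a
  meetAtLast S₂ ∉S₁ x∈S₁ x∈ with ∈-++⁻ S₂ x∈
  ... | inj₁ x∈S₂        = ⊥-elim (All.lookup ∉S₁ x∈S₂ x∈S₁)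
  ... | inj₂ (here refl) = refl

  hubOutFan : ∀ {h} → Hub h → OutFan h
  hubOutFan hub = outFan hub hub stay stay λ { (here refl) _ → refl }

  hubInFan : ∀ {h} → Hub h → InFan h
  hubInFan hub = inFan hub hub stay stay λ { (here refl) _ → refl }

  module TrueGadget (C : Fin (m Φ)) (j : Fin 3) (fx : f (cl Φ C j) ≡ true) where
    open Gadget C j

    y→w : G (y C j) (w C j)
    y→w = alongCycle fx yw∈cycle

    w→t : G (w C j) (t C j)
    w→t = alongCycle fx wt∈cycle

    r⇝y : BoundedWalk r (y C j) (r ∷ cycleTail earlier ++ [ y C j ])
    r⇝y = walkAlong r (cycleTail earlier) (y C j) (alongCycle fx ∘ edges-toY)

    t⇝r : BoundedWalk (t C j) r (t C j ∷ cycleTail later ++ [ r ])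
    t⇝r = walkAlong (t C j) (cycleTail later) r (alongCycle fx ∘ edges-fromT)

    outY : OutFan (y C j)
    outY = outFan hubR hubQ (y→w ◅ w→t ◅ t⇝r) (fixed (yu C j) ◅ uz-arc C j fx ◅ fixed (zq C) ◅ stay)
      (meetAtHead (off (λ ()) ∷ off (λ ()) ∷ off (λ ()) ∷ []))
      where
      off : ∀ {v} → ¬ OnCycle v → v ∉ y C j ∷ w C j ∷ t C j ∷ cycleTail later ++ [ r ]
      off = offCycle∉ (tt ∷ tt ∷ OnCycle-fromT)

    outW : OutFan (w C j)
    outW = outFan hubR hubQ (w→t ◅ t⇝r) (fixed (wq C j) ◅ stay) (meetAtHead (offCycle∉ (tt ∷ OnCycle-fromT) (λ ()) ∷ []))

    outT : OutFan (t C j)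
    outT = outFan hubR hubQ t⇝r (fixed (tu C j) ◅ fixed (uw C j) ◅ fixed (wq C j) ◅ stay)
      (meetAtHead (offCycle∉ OnCycle-fromT (λ ()) ∷ ∉-∷ (λ ()) w∉later ∷ offCycle∉ OnCycle-fromT (λ ()) ∷ []))

    outU : OutFan (u C j)
    outU = outFan hubR hubQ (fixed (uw C j) ◅ w→t ◅ t⇝r) (uz-arc C j fx ◅ fixed (zq C) ◅ stay)
      (meetAtHead (∉-∷ (λ ()) (off (λ ())) ∷ ∉-∷ (λ ()) (off (λ ())) ∷ []))
      where
      off : ∀ {v} → ¬ OnCycle v → v ∉ w C j ∷ t C j ∷ cycleTail later ++ [ r ]
      off = offCycle∉ (tt ∷ OnCycle-fromT)

    inY : InFan (y C j)
    inY = inFan hubR hubP r⇝y (fixed (pt C j) ◅ fixed (tu C j) ◅ fixed (uy C j) ◅ stay)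
      (meetAtLast (p ∷ t C j ∷ u C j ∷ []) (offCycle∉ OnCycle-toY (λ ()) ∷ t∉earlier ∷ offCycle∉ OnCycle-toY (λ ()) ∷ []))

    inW : InFan (w C j)
    inW = inFan hubR hubP (r⇝y ▻ y→w) (fixed (pt C j) ◅ fixed (tu C j) ◅ fixed (uw C j) ◅ stay)
      (meetAtLast (p ∷ t C j ∷ u C j ∷ [])
        (off (λ ()) ∷ ∉-++ (r ∷ cycleTail earlier ++ [ y C j ]) t∉earlier (∉-∷ (λ ()) λ ()) ∷ off (λ ()) ∷ []))
      where
      off : ∀ {v} → ¬ OnCycle v → v ∉ (r ∷ cycleTail earlier ++ [ y C j ]) ++ [ w C j ]
      off = offCycle∉ (All-++⁺ OnCycle-toY (tt ∷ []))

    inT : InFan (t C j)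
    inT = inFan hubR hubP (r⇝y ▻ y→w ▻ w→t) (fixed (pt C j) ◅ stay)
      (meetAtLast (p ∷ []) (offCycle∉ (All-++⁺ (All-++⁺ OnCycle-toY (tt ∷ [])) (tt ∷ [])) (λ ()) ∷ []))

    inU : InFan (u C j)
    inU = inFan hubR hubP (r⇝y ▻ fixed (yu C j)) (fixed (pt C j) ◅ fixed (tu C j) ◅ stay)
      (meetAtLast (p ∷ t C j ∷ [])
        (∉-++ (r ∷ cycleTail earlier ++ [ y C j ]) (offCycle∉ OnCycle-toY (λ ())) (∉-∷ (λ ()) λ ()) ∷
         ∉-++ (r ∷ cycleTail earlier ++ [ y C j ]) t∉earlier (∉-∷ (λ ()) λ ()) ∷ []))

  module FalseGadget (C : Fin (m Φ)) (j : Fin 3) (fx : f (cl Φ C j) ≡ false) where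
    open Gadget C j

    w→y : G (w C j) (y C j)
    w→y = againstCycle fx yw∈cycle

    t→w : G (t C j) (w C j)
    t→w = againstCycle fx wt∈cycle

    y⇝r : BoundedWalk (y C j) r (r ∷ cycleTail earlier ++ [ y C j ])
    y⇝r = walkAgainst r (cycleTail earlier) (y C j) (againstCycle fx ∘ edges-toY)

    r⇝t : BoundedWalk r (t C j) (t C j ∷ cycleTail later ++ [ r ])
    r⇝t = walkAgainst (t C j) (cycleTail later) r (againstCycle fx ∘ edges-fromT)

    outY : OutFan (y C j)
    outY = outFan hubR hubQ y⇝r (fixed (yu C j) ◅ fixed (uw C j) ◅ fixed (wq C j) ◅ stay)
      (meetAtHead (offCycle∉ OnCycle-toY (λ ()) ∷ w∉earlier ∷ offCycle∉ OnCycle-toY (λ ()) ∷ []))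

    outW : OutFan (w C j)
    outW = outFan hubR hubQ (w→y ◅ y⇝r) (fixed (wq C j) ◅ stay) (meetAtHead (offCycle∉ (tt ∷ OnCycle-toY) (λ ()) ∷ []))

    outT : OutFan (t C j)
    outT = outFan hubR hubQ (fixed (tu C j) ◅ fixed (uy C j) ◅ y⇝r) (t→w ◅ fixed (wq C j) ◅ stay)
      (meetAtHead (∉-∷ (λ ()) (∉-∷ (λ ()) w∉earlier) ∷ ∉-∷ (λ ()) (∉-∷ (λ ()) (offCycle∉ OnCycle-toY (λ ()))) ∷ []))

    outU : OutFan (u C j)
    outU = outFan hubR hubQ (fixed (uy C j) ◅ y⇝r) (fixed (uw C j) ◅ fixed (wq C j) ◅ stay)
      (meetAtHead (∉-∷ (λ ()) w∉earlier ∷ ∉-∷ (λ ()) (offCycle∉ OnCycle-toY (λ ())) ∷ []))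

    inY : InFan (y C j)
    inY = inFan hubR hubP (r⇝t ▻ t→w ▻ w→y) (fixed (pz C) ◅ zu-arc C j fx ◅ fixed (uy C j) ◅ stay)
      (meetAtLast (p ∷ z C ∷ u C j ∷ []) (off (λ ()) ∷ off (λ ()) ∷ off (λ ()) ∷ []))
      where
      off : ∀ {v} → ¬ OnCycle v → v ∉ ((t C j ∷ cycleTail later ++ [ r ]) ++ [ w C j ]) ++ [ y C j ]
      off = offCycle∉ (All-++⁺ (All-++⁺ OnCycle-fromT (tt ∷ [])) (tt ∷ []))

    inW : InFan (w C j)
    inW = inFan hubR hubP (r⇝t ▻ t→w) (fixed (pz C) ◅ zu-arc C j fx ◅ fixed (uw C j) ◅ stay)
      (meetAtLast (p ∷ z C ∷ u C j ∷ []) (off (λ ()) ∷ off (λ ()) ∷ off (λ ()) ∷ []))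
      where
      off : ∀ {v} → ¬ OnCycle v → v ∉ (t C j ∷ cycleTail later ++ [ r ]) ++ [ w C j ]
      off = offCycle∉ (All-++⁺ OnCycle-fromT (tt ∷ []))

    inT : InFan (t C j)
    inT = inFan hubR hubP r⇝t (fixed (pt C j) ◅ stay) (meetAtLast (p ∷ []) (offCycle∉ OnCycle-fromT (λ ()) ∷ []))

    inU : InFan (u C j)
    inU = inFan hubR hubP (r⇝t ▻ fixed (tu C j)) (fixed (pz C) ◅ zu-arc C j fx ◅ stay)
      (meetAtLast (p ∷ z C ∷ []) (off (λ ()) (λ ()) ∷ off (λ ()) (λ ()) ∷ []))
      where
      off : ∀ {v} → ¬ OnCycle v → v ≢ u C j → v ∉ (t C j ∷ cycleTail later ++ [ r ]) ++ [ u C j ]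
      off ¬on v≢u = ∉-++ (t C j ∷ cycleTail later ++ [ r ]) (offCycle∉ OnCycle-fromT ¬on) (∉-∷ v≢u λ ())

  outFanZ : ∀ C → OutFan (z C)
  outFanZ C with feasible C
  ... | _ , (j , fx) = outFan hubR hubQ (zu-arc C j fx ◅ fixed (uy C j) ◅ FalseGadget.y⇝r C j fx) (fixed (zq C) ◅ stay)
    (meetAtHead (∉-∷ (λ ()) (∉-∷ (λ ()) (offCycle∉ (Gadget.OnCycle-toY C j) (λ ()))) ∷ []))

  inFanZ : ∀ C → InFan (z C)
  inFanZ C with feasible C
  ... | (j , fx) , _ = inFan hubR hubP (TrueGadget.r⇝y C j fx ▻ fixed (yu C j) ▻ uz-arc C j fx) (fixed (pz C) ◅ stay)
    (meetAtLast (p ∷ []) (∉-++ _ (∉-++ _ (offCycle∉ (Gadget.OnCycle-toY C j) (λ ())) (∉-∷ (λ ()) λ ())) (∉-∷ (λ ()) λ ()) ∷ []))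

  outFanOf : ∀ a → OutFan a
  outFanOf p = hubOutFan hubP
  outFanOf q = hubOutFan hubQ
  outFanOf r = hubOutFan hubR
  outFanOf (z C) = outFanZ C
  outFanOf (t C j) with f (cl Φ C j) in fx
  ... | true  = TrueGadget.outT C j fx
  ... | false = FalseGadget.outT C j fx
  outFanOf (u C j) with f (cl Φ C j) in fx
  ... | true  = TrueGadget.outU C j fx
  ... | false = FalseGadget.outU C j fx
  outFanOf (w C j) with f (cl Φ C j) in fx
  ... | true  = TrueGadget.outW C j fx
  ... | false = FalseGadget.outW C j fx
  outFanOf (y C j) with f (cl Φ C j) in fx
  ... | true  = TrueGadget.outY C j fx
  ... | false = FalseGadget.outY C j fx

  inFanOf : ∀ a → InFan a
  inFanOf p = hubInFan hubP
  inFanOf q = hubInFan hubQ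
  inFanOf r = hubInFan hubR
  inFanOf (z C) = inFanZ C
  inFanOf (t C j) with f (cl Φ C j) in fx
  ... | true  = TrueGadget.inT C j fx
  ... | false = FalseGadget.inT C j fx
  inFanOf (u C j) with f (cl Φ C j) in fx
  ... | true  = TrueGadget.inU C j fx
  ... | false = FalseGadget.inU C j fx
  inFanOf (w C j) with f (cl Φ C j) in fx
  ... | true  = TrueGadget.inW C j fx
  ... | false = FalseGadget.inW C j fx
  inFanOf (y C j) with f (cl Φ C j) in fx
  ... | true  = TrueGadget.inY C j fx
  ... | false = FalseGadget.inY C j fx

  open import Data.List.Membership.DecPropositional (_≟ⱽ_ {m Φ}) using (_∈?_)

  outFan-avoiding : ∀ {a v} → OutFan a → a ≢ v → Σ V λ h → Hub h × Σ (Walk G a h) λ W → v ∉ verts W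
  outFan-avoiding {v = v} (outFan hub₁ hub₂ (W₁ , W₁⊆) (W₂ , W₂⊆) meet) a≢v with v ∈? _
  ... | no v∉S₁  = _ , hub₁ , W₁ , v∉S₁ ∘ W₁⊆
  ... | yes v∈S₁ = _ , hub₂ , W₂ , λ v∈W₂ → a≢v (sym (meet v∈S₁ (W₂⊆ v∈W₂)))

  inFan-avoiding : ∀ {a v} → InFan a → a ≢ v → Σ V λ h → Hub h × Σ (Walk G h a) λ W → v ∉ verts W
  inFan-avoiding {v = v} (inFan hub₁ hub₂ (W₁ , W₁⊆) (W₂ , W₂⊆) meet) a≢v with v ∈? _
  ... | no v∉S₁  = _ , hub₁ , W₁ , v∉S₁ ∘ W₁⊆
  ... | yes v∈S₁ = _ , hub₂ , W₂ , λ v∈W₂ → a≢v (sym (meet v∈S₁ (W₂⊆ v∈W₂)))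

  hubWalk : ∀ {h₁ h₂ v} → Hub h₁ → Hub h₂ → h₁ ≢ v → h₂ ≢ v → Σ (Walk G h₁ h₂) λ W → v ∉ verts W
  hubWalk hubP hubP h₁≢v _ = [] , ∉-∷ (h₁≢v ∘ sym) λ ()
  hubWalk hubQ hubQ h₁≢v _ = [] , ∉-∷ (h₁≢v ∘ sym) λ ()
  hubWalk hubR hubR h₁≢v _ = [] , ∉-∷ (h₁≢v ∘ sym) λ ()
  hubWalk hubP hubQ h₁≢v h₂≢v = fixed pq ∷ [] , ∉-∷ (h₁≢v ∘ sym) (∉-∷ (h₂≢v ∘ sym) λ ())
  hubWalk hubP hubR h₁≢v h₂≢v = fixed pr ∷ [] , ∉-∷ (h₁≢v ∘ sym) (∉-∷ (h₂≢v ∘ sym) λ ())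
  hubWalk hubQ hubP h₁≢v h₂≢v = fixed qp ∷ [] , ∉-∷ (h₁≢v ∘ sym) (∉-∷ (h₂≢v ∘ sym) λ ())
  hubWalk hubQ hubR h₁≢v h₂≢v = fixed qr ∷ [] , ∉-∷ (h₁≢v ∘ sym) (∉-∷ (h₂≢v ∘ sym) λ ())
  hubWalk hubR hubP h₁≢v h₂≢v = fixed rp ∷ [] , ∉-∷ (h₁≢v ∘ sym) (∉-∷ (h₂≢v ∘ sym) λ ())
  hubWalk hubR hubQ h₁≢v h₂≢v = fixed rq ∷ [] , ∉-∷ (h₁≢v ∘ sym) (∉-∷ (h₂≢v ∘ sym) λ ())

  avoiding : ∀ v a b → a ≢ v → b ≢ v → Σ (Walk G a b) λ W → v ∉ verts W
  avoiding v a b a≢v b≢v with outFan-avoiding (outFanOf a) a≢v | inFan-avoiding (inFanOf b) b≢v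
  ... | _ , hub₁ , W₁ , v∉W₁ | _ , hub₂ , W₂ , v∉W₂ with hubWalk hub₁ hub₂ (endAvoids W₁ v∉W₁) (startAvoids W₂ v∉W₂)
    where
    endAvoids : ∀ {a h} (W : Walk G a h) → v ∉ verts W → h ≢ v
    endAvoids W v∉W h≡v = v∉W (subst (_∈ verts W) h≡v (end∈verts W))
    startAvoids : ∀ {h b} (W : Walk G h b) → v ∉ verts W → h ≢ v
    startAvoids W v∉W h≡v = v∉W (subst (_∈ verts W) h≡v (start∈verts W))
  ... | W , v∉W = W₁ ++ᵂ W ++ᵂ W₂ , ∉-verts-++ᵂ W₁ _ v∉W₁ (∉-verts-++ᵂ W W₂ v∉W v∉W₂)

  twoVertexConnectedOrientation : TwoVertexConnected G
  twoVertexConnectedOrientation = twoVertexConnected avoiding (p , q , r , (λ ()) , (λ ()) , (λ ()))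

module Backward (Φ : Instance) (ord : Ordering Φ) (o : Orientation Φ ord)
                (connected : TwoVertexConnected (OArc Φ ord o)) where
  open Construction Φ ord

  G : V → V → Set
  G = OArc Φ ord o

  open Walks _≟ⱽ_ G
  open TwoConnected (proj₂ connected)

  Index : Set
  Index = Fin (length E)

  data EdgeShape : V × V → Set where
    clauseEdge : ∀ C j → EdgeShape (z C , u C j)
    cycleEdge  : ∀ {a b} → OnCycle a → OnCycle b → EdgeShape (a , b)

  edgeShape : ∀ {e} → e ∈ E → EdgeShape e
  edgeShape e∈ with ∈-++⁻ clauseEdges e∈
  ... | inj₁ e∈clause with find (∈-concatMap⁻ _ {xs = allFin (m Φ)} e∈clause)
  ...   | C , _ , e∈C with find (∈-concatMap⁻ (λ j → [ (z C , u C j) ]) {xs = allFin 3} e∈C)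
  ...     | j , _ , here refl = clauseEdge C j
  edgeShape e∈ | inj₂ e∈var with find (∈-concatMap⁻ _ {xs = allFin (n Φ)} e∈var)
  ... | x , _ , e∈cycle with pairsAlong-All _ (tt ∷ All-++⁺ (All-OnCycle-cycleTail (occurrences x)) (tt ∷ [])) e∈cycle
  ...   | onA , onB = cycleEdge onA onB

  -- each u, y, w, t is the head of exactly one edge, and each y, w, t the tail of exactly one
  headKey : V → Maybe V
  headKey (u C j) = just (u C j)
  headKey (y C j) = just (y C j)
  headKey (w C j) = just (w C j)
  headKey (t C j) = just (t C j)
  headKey _       = nothing

  tailKey : V → Maybe V
  tailKey (y C j) = just (y C j)
  tailKey (w C j) = just (w C j)
  tailKey (t C j) = just (t C j)
  tailKey _       = nothing

  clauseHeads : List V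
  clauseHeads = concatMap (λ C → concatMap (λ j → [ u C j ]) (allFin 3)) (allFin (m Φ))

  cycleVertices : List V
  cycleVertices = concatMap (cycleTail ∘ occurrences) (allFin (n Φ))

  private
    headKey-cycleTail : ∀ L → mapMaybe headKey (cycleTail L) ≡ cycleTail L
    headKey-cycleTail []            = refl
    headKey-cycleTail ((C , j) ∷ L) = cong (λ xs → y C j ∷ w C j ∷ t C j ∷ xs) (headKey-cycleTail L)

    tailKey-cycleTail : ∀ L → mapMaybe tailKey (cycleTail L) ≡ cycleTail L
    tailKey-cycleTail []            = refl
    tailKey-cycleTail ((C , j) ∷ L) = cong (λ xs → y C j ∷ w C j ∷ t C j ∷ xs) (tailKey-cycleTail L)

    concatMap-[] : ∀ {B : Set} (xs : List B) → concatMap (λ _ → [] {A = V}) xs ≡ []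
    concatMap-[] []       = refl
    concatMap-[] (_ ∷ xs) = concatMap-[] xs

  heads-E : mapMaybe (headKey ∘ proj₂) E ≡ clauseHeads ++ cycleVertices
  heads-E = begin
    mapMaybe κ E                                                  ≡⟨ mapMaybe-++ κ clauseEdges variableEdges ⟩
    mapMaybe κ clauseEdges ++ mapMaybe κ variableEdges           ≡⟨ cong₂ _++_ clausePart variablePart ⟩
    clauseHeads ++ cycleVertices                                 ∎
    where
    open ≡-Reasoning
    κ : V × V → Maybe V
    κ = headKey ∘ proj₂
    clausePart : mapMaybe κ clauseEdges ≡ clauseHeads
    clausePart = trans (mapMaybe-concatMap κ _ (allFin (m Φ)))
                       (concatMap-cong (λ C → mapMaybe-concatMap κ (λ j → [ (z C , u C j) ]) (allFin 3)) (allFin (m Φ)))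
    cyclePart : ∀ x → mapMaybe κ (cycleEdges (occurrences x)) ≡ cycleTail (occurrences x)
    cyclePart x = begin
      mapMaybe κ (cycleEdges L)                       ≡⟨ mapMaybe-pairsAlong-proj₂ headKey r (cycleTail L ++ [ r ]) ⟩
      mapMaybe headKey (cycleTail L ++ [ r ])          ≡⟨ mapMaybe-++ headKey (cycleTail L) [ r ] ⟩
      mapMaybe headKey (cycleTail L) ++ []             ≡⟨ ++-identityʳ _ ⟩
      mapMaybe headKey (cycleTail L)                   ≡⟨ headKey-cycleTail L ⟩
      cycleTail L                                      ∎
      where
      L : List Occurrence
      L = occurrences x
    variablePart : mapMaybe κ variableEdges ≡ cycleVertices
    variablePart = trans (mapMaybe-concatMap κ _ (allFin (n Φ))) (concatMap-cong cyclePart (allFin (n Φ)))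

  tails-E : mapMaybe (tailKey ∘ proj₁) E ≡ cycleVertices
  tails-E = begin
    mapMaybe κ E                                                  ≡⟨ mapMaybe-++ κ clauseEdges variableEdges ⟩
    mapMaybe κ clauseEdges ++ mapMaybe κ variableEdges           ≡⟨ cong (_++ mapMaybe κ variableEdges) clausePart ⟩
    mapMaybe κ variableEdges                                     ≡⟨ mapMaybe-concatMap κ _ (allFin (n Φ)) ⟩
    concatMap (mapMaybe κ ∘ cycleEdges ∘ occurrences) (allFin (n Φ)) ≡⟨ concatMap-cong cyclePart (allFin (n Φ)) ⟩
    cycleVertices                                                ∎
    where
    open ≡-Reasoning
    κ : V × V → Maybe V
    κ = tailKey ∘ proj₁
    clausePart : mapMaybe κ clauseEdges ≡ []
    clausePart = trans (mapMaybe-concatMap κ _ (allFin (m Φ))) (concatMap-[] (allFin (m Φ)))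
    cyclePart : ∀ x → mapMaybe κ (cycleEdges (occurrences x)) ≡ cycleTail (occurrences x)
    cyclePart x = trans (mapMaybe-pairsAlong-proj₁ tailKey r (cycleTail (occurrences x)) r) (tailKey-cycleTail (occurrences x))

  private
    ∈-clauseOf⁻ : ∀ {C : Fin (m Φ)} {v : V} → v ∈ concatMap (λ j → [ u C j ]) (allFin 3) → ∃ λ j → v ≡ u C j
    ∈-clauseOf⁻ (here refl)                 = _ , refl
    ∈-clauseOf⁻ (there (here refl))         = _ , refl
    ∈-clauseOf⁻ (there (there (here refl))) = _ , refl
    ∈-clauseOf⁻ (there (there (there ())))

    ¬OnCycle-clauseHeads : ∀ {v} → v ∈ clauseHeads → ¬ OnCycle v
    ¬OnCycle-clauseHeads v∈ with find (∈-concatMap⁻ _ {xs = allFin (m Φ)} v∈)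
    ... | _ , _ , v∈C = ¬OnCycle-u (∈-clauseOf⁻ v∈C)
      where
      ¬OnCycle-u : ∀ {v : V} {C} → (∃ λ j → v ≡ u C j) → ¬ OnCycle v
      ¬OnCycle-u (_ , refl) ()

    OnCycle-cycleVertices : ∀ {v} → v ∈ cycleVertices → OnCycle v
    OnCycle-cycleVertices v∈ with find (∈-concatMap⁻ _ {xs = allFin (n Φ)} v∈)
    ... | x , _ , v∈x = All.lookup (All-OnCycle-cycleTail (occurrences x)) v∈x

    Unique-clauseHeads : Unique clauseHeads
    Unique-clauseHeads = Unique-concatMap _ (allFin⁺ _)
      (λ C → Unique-concatMap (λ j → [ u C j ]) (allFin⁺ 3) (λ _ → [] ∷ []) λ { (here refl) (here refl) → refl })
      λ v∈ v∈′ → sameClause (∈-clauseOf⁻ v∈) (∈-clauseOf⁻ v∈′)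
      where
      sameClause : ∀ {v C C′} → (∃ λ j → v ≡ u C j) → (∃ λ j → v ≡ u C′ j) → C ≡ C′
      sameClause (_ , refl) (_ , refl) = refl

    Unique-cycleVertices : Unique cycleVertices
    Unique-cycleVertices = Unique-concatMap (cycleTail ∘ occurrences) (allFin⁺ _)
      (λ x → Unique-cycleTail (occurrences x) (Unique-occurrences x)) sameVariable
      where
      sameVariable : ∀ {x x′ v} → v ∈ cycleTail (occurrences x) → v ∈ cycleTail (occurrences x′) → x ≡ x′
      sameVariable v∈ v∈′ with ∈-cycleTail⁻ _ v∈ | ∈-cycleTail⁻ _ v∈′
      ... | C , j , Cj∈ , at | C′ , j′ , C′j′∈ , at′ with gadget-unique at at′
      ...   | refl = trans (sym (∈-occurrences⁻ Cj∈)) (∈-occurrences⁻ C′j′∈)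

  Unique-heads : Unique (mapMaybe (headKey ∘ proj₂) E)
  Unique-heads = subst Unique (sym heads-E)
    (Unique-++⁺ Unique-clauseHeads Unique-cycleVertices λ v∈ → ¬OnCycle-clauseHeads v∈ ∘ OnCycle-cycleVertices)

  Unique-tails : Unique (mapMaybe (tailKey ∘ proj₁) E)
  Unique-tails = subst Unique (sym tails-E) Unique-cycleVertices

  sameHead : ∀ {i i′ : Index} {a a′ b} → lookup E i ≡ (a , b) → lookup E i′ ≡ (a′ , b) → headKey b ≡ just b → i ≡ i′
  sameHead eq eq′ key = lookup-key-injective (headKey ∘ proj₂) E Unique-heads
                          (trans (cong (headKey ∘ proj₂) eq) key) (trans (cong (headKey ∘ proj₂) eq′) key)

  sameTail : ∀ {i i′ : Index} {a b b′} → lookup E i ≡ (a , b) → lookup E i′ ≡ (a , b′) → tailKey a ≡ just a → i ≡ i′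
  sameTail eq eq′ key = lookup-key-injective (tailKey ∘ proj₁) E Unique-tails
                          (trans (cong (tailKey ∘ proj₁) eq) key) (trans (cong (tailKey ∘ proj₁) eq′) key)

  data ArcKind (a b : V) : Set where
    fixedArc    : Arc a b → ArcKind a b
    forwardArc  : ∀ i → o i ≡ true  → lookup E i ≡ (a , b) → ArcKind a b
    backwardArc : ∀ i → o i ≡ false → lookup E i ≡ (b , a) → ArcKind a b

  arcKind : ∀ {a b} → G a b → ArcKind a b
  arcKind (inj₁ arc) = fixedArc arc
  arcKind (inj₂ (i , oriented)) with orient⁻ (lookup E i) (o i) oriented
    where
    orient⁻ : ∀ {a b} e d → orient e d ≡ (a , b) → (d ≡ true × e ≡ (a , b)) ⊎ (d ≡ false × e ≡ (b , a))
    orient⁻ (_ , _) true  refl = inj₁ (refl , refl)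
    orient⁻ (_ , _) false refl = inj₂ (refl , refl)
  ... | inj₁ (oi , edge) = forwardArc i oi edge
  ... | inj₂ (oi , edge) = backwardArc i oi edge

  open LeavingArc

  private
    clash : ∀ {d : Bool} → d ≡ true → d ≡ false → ⊥
    clash refl ()

  sameOrientation : ∀ {i i′ : Index} {d} → i ≡ i′ → o i ≡ d → o i′ ≡ d
  sameOrientation refl oi = oi

  shapeAt : ∀ {i : Index} {a b} → lookup E i ≡ (a , b) → EdgeShape (a , b)
  shapeAt {i} eq = subst EdgeShape eq (edgeShape (∈-lookup i))

  noEdgeFromU : ∀ {i : Index} {C j a} → lookup E i ≡ (u C j , a) → ⊥
  noEdgeFromU eq with shapeAt eq
  ... | cycleEdge () _

  noEdgeIntoZ : ∀ {i : Index} {C a} → lookup E i ≡ (a , z C) → ⊥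
  noEdgeIntoZ eq with shapeAt eq
  ... | cycleEdge _ ()

  edgeFromZ : ∀ {i : Index} {C a} → lookup E i ≡ (z C , a) → ∃ λ j → a ≡ u C j
  edgeFromZ eq with shapeAt eq
  ... | clauseEdge _ j = j , refl
  ... | cycleEdge () _

  headOfTail : ∀ {i i′ : Index} {a b b′} → lookup E i ≡ (a , b) → lookup E i′ ≡ (a , b′) → tailKey a ≡ just a → b ≡ b′
  headOfTail eq eq′ key = cong proj₂ (trans (sym eq) (trans (cong (lookup E) (sameTail eq eq′ key)) eq′))

  indexOf : ∀ {e} → e ∈ E → Index
  indexOf = Any.index

  lookup-indexOf : ∀ {e} (e∈ : e ∈ E) → lookup E (indexOf e∈) ≡ e
  lookup-indexOf e∈ = sym (lookup-index e∈)

  yw wt zu : Fin (m Φ) → Fin 3 → Index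
  yw C j = indexOf (cycleEdge∈E (cl Φ C j) (Gadget.yw∈cycle C j))
  wt C j = indexOf (cycleEdge∈E (cl Φ C j) (Gadget.wt∈cycle C j))
  zu C j = indexOf (zu∈E C j)

  yw-edge : ∀ C j → lookup E (yw C j) ≡ (y C j , w C j)
  yw-edge C j = lookup-indexOf (cycleEdge∈E (cl Φ C j) (Gadget.yw∈cycle C j))

  wt-edge : ∀ C j → lookup E (wt C j) ≡ (w C j , t C j)
  wt-edge C j = lookup-indexOf (cycleEdge∈E (cl Φ C j) (Gadget.wt∈cycle C j))

  zu-edge : ∀ C j → lookup E (zu C j) ≡ (z C , u C j)
  zu-edge C j = lookup-indexOf (zu∈E C j)

  forward : Fin (m Φ) → Fin 3 → Bool
  forward C j = o (yw C j)

  EdgeInto EdgeOutOf : V → Bool → Set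
  EdgeInto  b d = ∃ λ i → o i ≡ d × ∃ λ s → lookup E i ≡ (s , b)
  EdgeOutOf a d = ∃ λ i → o i ≡ d × ∃ λ s → lookup E i ≡ (a , s)

  module Local (C : Fin (m Φ)) (j : Fin 3) where

    enterY : EdgeInto (y C j) true ⊎ forward C j ≡ false
    enterY with inNeighbourAvoiding p {y C j} {u C j} (λ ()) (λ ()) (λ ())
    ... | s , arc , s≢u with arcKind arc
    ...   | fixedArc (uy _ _)     = ⊥-elim (s≢u refl)
    ...   | forwardArc i oi edge  = inj₁ (i , oi , s , edge)
    ...   | backwardArc i oi edge = inj₂ (sameOrientation (sameTail edge (yw-edge C j) refl) oi)

    leaveY : EdgeInto (y C j) false ⊎ forward C j ≡ true
    leaveY with outNeighbourAvoiding p {y C j} {u C j} (λ ()) (λ ()) (λ ())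
    ... | s , arc , s≢u with arcKind arc
    ...   | fixedArc (yu _ _)     = ⊥-elim (s≢u refl)
    ...   | forwardArc i oi edge  = inj₂ (sameOrientation (sameTail edge (yw-edge C j) refl) oi)
    ...   | backwardArc i oi edge = inj₁ (i , oi , s , edge)

    leaveW : o (wt C j) ≡ true ⊎ forward C j ≡ false
    leaveW with outNeighbourAvoiding p {w C j} {q} (λ ()) (λ ()) (λ ())
    ... | s , arc , s≢q with arcKind arc
    ...   | fixedArc (wq _ _)     = ⊥-elim (s≢q refl)
    ...   | forwardArc i oi edge  = inj₁ (sameOrientation (sameTail edge (wt-edge C j) refl) oi)
    ...   | backwardArc i oi edge = inj₂ (sameOrientation (sameHead edge (yw-edge C j) refl) oi)

    enterW : forward C j ≡ true ⊎ o (wt C j) ≡ false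
    enterW with inNeighbourAvoiding p {w C j} {u C j} (λ ()) (λ ()) (λ ())
    ... | s , arc , s≢u with arcKind arc
    ...   | fixedArc (uw _ _)     = ⊥-elim (s≢u refl)
    ...   | forwardArc i oi edge  = inj₁ (sameOrientation (sameHead edge (yw-edge C j) refl) oi)
    ...   | backwardArc i oi edge = inj₂ (sameOrientation (sameTail edge (wt-edge C j) refl) oi)

    leaveT : EdgeOutOf (t C j) true ⊎ o (wt C j) ≡ false
    leaveT with outNeighbourAvoiding p {t C j} {u C j} (λ ()) (λ ()) (λ ())
    ... | s , arc , s≢u with arcKind arc
    ...   | fixedArc (tu _ _)     = ⊥-elim (s≢u refl)
    ...   | forwardArc i oi edge  = inj₁ (i , oi , s , edge)
    ...   | backwardArc i oi edge = inj₂ (sameOrientation (sameHead edge (wt-edge C j) refl) oi)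

    enterT : o (wt C j) ≡ true ⊎ EdgeOutOf (t C j) false
    enterT with inNeighbourAvoiding q {t C j} {p} (λ ()) (λ ()) (λ ())
    ... | s , arc , s≢p with arcKind arc
    ...   | fixedArc (pt _ _)     = ⊥-elim (s≢p refl)
    ...   | forwardArc i oi edge  = inj₁ (sameOrientation (sameHead edge (wt-edge C j) refl) oi)
    ...   | backwardArc i oi edge = inj₂ (i , oi , s , edge)

    -- if y → w, every arc leaving {u, y} ends in w unless u → z
    forward⇒u→z : forward C j ≡ true → o (zu C j) ≡ false
    forward⇒u→z fwd with o (zu C j) in ozu
    ... | false = refl
    ... | true  = ⊥-elim (noCutVertex {a = u C j} {b = p} (λ v → (v ≟ⱽ u C j) ⊎-dec (v ≟ⱽ y C j)) (inj₁ refl)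
                                      (λ { (inj₁ ()) ; (inj₂ ()) }) (λ ()) (λ ()) intoW)
      where
      intoW : (ℓ : LeavingArc (λ v → v ≡ u C j ⊎ v ≡ y C j)) → source ℓ ≡ w C j ⊎ target ℓ ≡ w C j
      intoW (leaving (inj₁ refl) ∉S arc) with arcKind arc
      ... | fixedArc (uy _ _)     = ⊥-elim (∉S (inj₂ refl))
      ... | fixedArc (uw _ _)     = inj₂ refl
      ... | forwardArc i _ edge   = ⊥-elim (noEdgeFromU edge)
      ... | backwardArc i oi edge = ⊥-elim (clash ozu (sameOrientation (sameHead edge (zu-edge C j) refl) oi))
      intoW (leaving (inj₂ refl) ∉S arc) with arcKind arc
      ... | fixedArc (yu _ _)     = ⊥-elim (∉S (inj₁ refl))
      ... | forwardArc i _ edge   = inj₂ (headOfTail edge (yw-edge C j) refl)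
      ... | backwardArc i oi edge with enterY
      ...   | inj₁ (i′ , oi′ , _ , edge′) = ⊥-elim (clash oi′ (sameOrientation (sameHead edge edge′ refl) oi))
      ...   | inj₂ backward           = ⊥-elim (clash fwd backward)

    -- if w → y, every arc entering {u, y, w} starts in t unless z → u
    backward⇒z→u : forward C j ≡ false → o (zu C j) ≡ true
    backward⇒z→u bwd with o (zu C j) in ozu
    ... | true  = refl
    ... | false = ⊥-elim (noCutVertex {a = p} {b = u C j} (λ v → ¬? (U? v)) (λ { (inj₁ ()) ; (inj₂ (inj₁ ())) ; (inj₂ (inj₂ ())) })
                                      (λ ¬U → ¬U (inj₁ refl)) (λ ()) (λ ()) fromT)
      where
      U : V → Set
      U v = v ≡ u C j ⊎ v ≡ y C j ⊎ v ≡ w C j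
      U? : Decidable U
      U? v = (v ≟ⱽ u C j) ⊎-dec (v ≟ⱽ y C j) ⊎-dec (v ≟ⱽ w C j)
      fromT : (ℓ : LeavingArc (λ v → ¬ U v)) → source ℓ ≡ t C j ⊎ target ℓ ≡ t C j
      fromT (leaving ¬Us ¬¬Ut arc) = inj₁ (entering (decidable-stable (U? _) ¬¬Ut) ¬Us arc)
        where
        entering : ∀ {s b} → U b → ¬ U s → G s b → s ≡ t C j
        entering (inj₁ refl) ¬Us arc with arcKind arc
        ... | fixedArc (tu _ _)     = refl
        ... | fixedArc (yu _ _)     = ⊥-elim (¬Us (inj₂ (inj₁ refl)))
        ... | forwardArc i oi edge  = ⊥-elim (clash (sameOrientation (sameHead edge (zu-edge C j) refl) oi) ozu)
        ... | backwardArc i _ edge  = ⊥-elim (noEdgeFromU edge)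
        entering (inj₂ (inj₁ refl)) ¬Us arc with arcKind arc
        ... | fixedArc (uy _ _)     = ⊥-elim (¬Us (inj₁ refl))
        ... | backwardArc i _ edge  = ⊥-elim (¬Us (inj₂ (inj₂ (headOfTail edge (yw-edge C j) refl))))
        ... | forwardArc i oi edge with leaveY
        ...   | inj₁ (i′ , oi′ , _ , edge′) = ⊥-elim (clash (sameOrientation (sameHead edge edge′ refl) oi) oi′)
        ...   | inj₂ fwd                    = ⊥-elim (clash fwd bwd)
        entering (inj₂ (inj₂ refl)) ¬Us arc with arcKind arc
        ... | fixedArc (uw _ _)     = ⊥-elim (¬Us (inj₁ refl))
        ... | forwardArc i oi edge  = ⊥-elim (clash (sameOrientation (sameHead edge (yw-edge C j) refl) oi) bwd)
        ... | backwardArc i _ edge  = headOfTail edge (wt-edge C j) refl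

  forward-step : ∀ {C j C′ j′} {k : Index} → lookup E k ≡ (t C j , y C′ j′) → forward C′ j′ ≡ forward C j
  forward-step {C} {j} {C′} {j′} edgeK with forward C j in fwd
  ... | true with Local.leaveW C j
  ...   | inj₂ bwd = ⊥-elim (clash fwd bwd)
  ...   | inj₁ wt-true with Local.leaveT C j
  ...     | inj₂ wt-false = ⊥-elim (clash wt-true wt-false)
  ...     | inj₁ (i , oi , _ , edge) with Local.leaveY C′ j′
  ...       | inj₂ fwd′ = fwd′
  ...       | inj₁ (i′ , oi′ , _ , edge′) =
              ⊥-elim (clash (sameOrientation (sameTail edge edgeK refl) oi) (sameOrientation (sameHead edge′ edgeK refl) oi′))
  forward-step {C} {j} {C′} {j′} edgeK | false with Local.enterW C j
  ...   | inj₁ fwd′ = ⊥-elim (clash fwd′ fwd)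
  ...   | inj₂ wt-false with Local.enterT C j
  ...     | inj₁ wt-true = ⊥-elim (clash wt-true wt-false)
  ...     | inj₂ (i , oi , _ , edge) with Local.enterY C′ j′
  ...       | inj₂ bwd′ = bwd′
  ...       | inj₁ (i′ , oi′ , _ , edge′) =
              ⊥-elim (clash (sameOrientation (sameHead edge′ edgeK refl) oi′) (sameOrientation (sameTail edge edgeK refl) oi))

  forward-constant : ∀ x A C j K → occurrences x ≡ A ++ (C , j) ∷ K →
                     ∀ {C′ j′} → (C′ , j′) ∈ (C , j) ∷ K → forward C′ j′ ≡ forward C j
  forward-constant x A C j K split (here refl) = refl
  forward-constant x A C j ((C₂ , j₂) ∷ K) split (there C′j′∈) =
    trans (forward-constant x (A ++ [ (C , j) ]) C₂ j₂ K split′ C′j′∈)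
          (forward-step (lookup-indexOf (cycleEdge∈E x (consecutive∈cycle x A C j C₂ j₂ K split))))
    where
    split′ : occurrences x ≡ (A ++ [ (C , j) ]) ++ (C₂ , j₂) ∷ K
    split′ = trans split (sym (++-assoc A [ (C , j) ] ((C₂ , j₂) ∷ K)))

  firstForward : List Occurrence → Bool
  firstForward []            = true
  firstForward ((C , j) ∷ _) = forward C j

  assignment : Assignment Φ
  assignment x = firstForward (occurrences x)

  forward≡assignment : ∀ C j → forward C j ≡ assignment (cl Φ C j)
  forward≡assignment C j = fromFirst (occurrences (cl Φ C j)) refl (∈-occurrences C j)
    where
    fromFirst : ∀ L → occurrences (cl Φ C j) ≡ L → (C , j) ∈ L → forward C j ≡ firstForward L
    fromFirst ((C₀ , j₀) ∷ K) split Cj∈ = forward-constant (cl Φ C j) [] C₀ j₀ K split Cj∈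

  someU→Z : ∀ C → ∃ λ j → o (zu C j) ≡ false
  someU→Z C with inNeighbourAvoiding q {z C} {p} (λ ()) (λ ()) (λ ())
  ... | s , arc , s≢p with arcKind arc
  ...   | fixedArc (pz _)        = ⊥-elim (s≢p refl)
  ...   | forwardArc i _ edge    = ⊥-elim (noEdgeIntoZ edge)
  ...   | backwardArc i oi edge with edgeFromZ edge
  ...     | j , refl = j , sameOrientation (sameHead edge (zu-edge C j) refl) oi

  someZ→U : ∀ C → ∃ λ j → o (zu C j) ≡ true
  someZ→U C with outNeighbourAvoiding p {z C} {q} (λ ()) (λ ()) (λ ())
  ... | s , arc , s≢q with arcKind arc
  ...   | fixedArc (zq _)        = ⊥-elim (s≢q refl)
  ...   | backwardArc i _ edge   = ⊥-elim (noEdgeIntoZ edge)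
  ...   | forwardArc i oi edge with edgeFromZ edge
  ...     | j , refl = j , sameOrientation (sameHead edge (zu-edge C j) refl) oi

  assignment-feasible : Feasible Φ assignment
  assignment-feasible C with someU→Z C | someZ→U C
  ... | j₁ , u→z | j₂ , z→u = (j₁ , trans (sym (forward≡assignment C j₁)) forward₁) ,
                              (j₂ , trans (sym (forward≡assignment C j₂)) forward₂)
    where
    forward₁ : forward C j₁ ≡ true
    forward₁ with forward C j₁ in fwd
    ... | true  = refl
    ... | false = ⊥-elim (clash (Local.backward⇒z→u C j₁ fwd) u→z)
    forward₂ : forward C j₂ ≡ false
    forward₂ with forward C j₂ in fwd
    ... | false = refl
    ... | true  = ⊥-elim (clash z→u (Local.forward⇒u→z C j₂ fwd))

lemma2 : (Φ : Instance) (ord : Ordering Φ) →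
    (∃ λ (f : Assignment Φ) → Feasible Φ f) ⇔
    (∃ λ (o : Orientation Φ ord) → TwoVertexConnected (OArc Φ ord o))
lemma2 Φ ord = mk⇔
  (λ (f , feasible) → Forward.orientation Φ ord f feasible , Forward.twoVertexConnectedOrientation Φ ord f feasible)
  (λ (o , connected) → Backward.assignment Φ ord o connected , Backward.assignment-feasible Φ ord o connected)
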